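{- Let $k\ge 3$ and let $G$ be an edge-girth-regular graph $egr(n,k,g,\lambda)$ with even girth $g=2h$. Then $$n\ge 2\frac{(k-1)^{h}-1}{k-2}+\left\lceil\frac{((k-1)^{h}-\lambda)^2}{(k-3)\lambda+(k-1)^{h}-2\max\left(0,\left\lceil\frac{\lambda^2}{2(k-1)^{h-1}}-\frac{\lambda}{2}\right\rceil\right)}\right\rceil.$$
   Context: All graphs are simple, finite and connected, and valency $k>2$ is assumed throughout. An edge-girth-regular graph $egr(n,k,g,\lambda)$ is a $k$-regular graph of girth $g$ on $n$ vertices in which every edge is contained in exactly $\lambda$ distinct cycles of length $g$. -}

module Defs where

open import Data.Nat as ℕ using (ℕ; zero; suc; _∸_; _≤_; _<_)
open import Data.Fin using (Fin)
open import Data.Fin.Properties using () renaming (_≟_ to _≟ᶠ_)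
open import Data.List using (List; []; _∷_; _++_; [_]; length; map; concatMap; filter; allFin)
open import Data.List.Relation.Unary.Linked using (Linked; linked?)
open import Data.List.Relation.Unary.Unique.Propositional using (Unique)
open import Data.Product using (Σ; ∃; _×_; _,_)
open import Data.Empty using (⊥)
open import Relation.Nullary using (¬_; Dec; yes; no)
open import Relation.Nullary.Decidable using (_×-dec_)
open import Relation.Binary using (Rel; Decidable; Symmetric; Irreflexive)
open import Relation.Binary.PropositionalEquality using (_≡_)
open import Relation.Binary.Construct.Closure.ReflexiveTransitive using (Star)
open import Data.Integer as ℤ using (ℤ; +_)
open import Data.Rational as ℚ using (ℚ; 0ℚ; ceiling)

record Graph (n : ℕ) : Set₁ where
  field
    Adj    : Rel (Fin n) _
    adj?   : Decidable Adj
    sym    : Symmetric Adj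
    irrefl : ∀ {u} → ¬ Adj u u

module _ {n : ℕ} (G : Graph n) where
  open Graph G

  Connected : Set
  Connected = ∀ u v → Star Adj u v

  degree : Fin n → ℕ
  degree u = length (filter (adj? u) (allFin n))

  Regular : ℕ → Set
  Regular k = ∀ u → degree u ≡ k

  -- A cycle given as its list of vertices x₀ x₁ … x_{ℓ-1} (ℓ = length):
  -- the vertices are pairwise distinct and x₀ ~ x₁ ~ … ~ x_{ℓ-1} ~ x₀.
  -- (A genuine cycle additionally needs ℓ ≥ 3; this is imposed where used.)
  IsCycleList : List (Fin n) → Set
  IsCycleList []       = ⊥
  IsCycleList (x ∷ xs) = Unique (x ∷ xs) × Linked Adj ((x ∷ xs) ++ [ x ])

  isCycleList? : (w : List (Fin n)) → Dec (IsCycleList w)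
  isCycleList? []       = no (λ ())
  isCycleList? (x ∷ xs) =
    Data.List.Relation.Unary.Unique.DecPropositional.unique? _≟ᶠ_ (x ∷ xs)
      ×-dec linked? adj? ((x ∷ xs) ++ [ x ])
    where import Data.List.Relation.Unary.Unique.DecPropositional

  HasCycleOfLength : ℕ → Set
  HasCycleOfLength ℓ = 3 ≤ ℓ × Σ (List (Fin n)) (λ w → length w ≡ ℓ × IsCycleList w)

  Girth : ℕ → Set
  Girth g = HasCycleOfLength g × (∀ ℓ → ℓ < g → ¬ HasCycleOfLength ℓ)

  allLists : ℕ → List (List (Fin n))
  allLists zero    = [] ∷ []
  allLists (suc m) = concatMap (λ x → map (x ∷_) (allLists m)) (allFin n)

  -- Number of distinct cycles of length g containing the edge uv.
  -- Every such cycle has exactly one vertex listing starting u, v, …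
  -- (traverse the cycle from u in the direction of v), so these cycles
  -- are counted by the lists u ∷ v ∷ rest (rest of length g ∸ 2)
  -- which are cycle lists.
  cyclesThroughEdge : ℕ → Fin n → Fin n → ℕ
  cyclesThroughEdge g u v =
    length (filter isCycleList? (map (λ r → u ∷ v ∷ r) (allLists (g ∸ 2))))

  EdgeGirthRegular : (k g λ' : ℕ) → Set
  EdgeGirthRegular k g λ' =
    Connected × Regular k × Girth g ×
    (∀ u v → Adj u v → cyclesThroughEdge g u v ≡ λ')

-- division with the convention p / 0 = 0 (only relevant in the
-- degenerate case where the denominator of the bound vanishes)
infixl 7 _÷₀_
_÷₀_ : ℚ → ℚ → ℚ
p ÷₀ q with q ℚ.≟ 0ℚ
... | yes _  = 0ℚ
... | no q≢0 = ℚ._÷_ p q {{ℚ.≢-nonZero q≢0}}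

ℕ→ℚ : ℕ → ℚ
ℕ→ℚ m = (+ m) ℚ./ 1

ℤ→ℚ : ℤ → ℚ
ℤ→ℚ z = z ℚ./ 1

egrBound : (k h λ' : ℕ) → ℚ
egrBound k h λ' =
  (ℕ→ℚ 2 ℚ.* (ℕ→ℚ N ℚ.- ℕ→ℚ 1)) ÷₀ ℕ→ℚ (k ∸ 2)
  ℚ.+ ℤ→ℚ (ceiling (ℤ→ℚ (num ℤ.* num) ÷₀ ℤ→ℚ den))
  where
    N : ℕ
    N = (k ∸ 1) ℕ.^ h
    m : ℤ
    m = (+ 0) ℤ.⊔ ceiling ((ℕ→ℚ (λ' ℕ.* λ') ÷₀ ℕ→ℚ (2 ℕ.* (k ∸ 1) ℕ.^ (h ∸ 1)))
                           ℚ.- (ℕ→ℚ λ' ÷₀ ℕ→ℚ 2))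
    num : ℤ
    num = (+ N) ℤ.- (+ λ')
    den : ℤ
    den = (+ ((k ∸ 3) ℕ.* λ')) ℤ.+ (+ N) ℤ.- ((+ 2) ℤ.* m)

-- Fix an edge uv, write h = h′ + 1, N = (k − 1)^h and M = (k − 1)^h′, and count non-backtracking
-- walks.  Since the girth is 2h, the walks of length at most h′ leaving u (not via v) or v (not via u)
-- end at pairwise distinct vertices, 2 (N − 1)/(k − 2) of them.  Let d z count the walks of length h
-- from u (not via v) ending at z, and let e z ∈ {0, 1} record whether z is reached from v (not via u)
-- in h′ steps.  A girth cycle through uv is exactly such a pair of walks, so Σ d e = λ, and the cycles
-- through the other edges at u give Σ d² + λ = (k − 1)(λ + M).  Cauchy–Schwarz on the support of e
-- gives λ² ≤ M Σ (d e)², hence Σ C(d e, 2) ≥ λ²/2M − λ/2; Cauchy–Schwarz on the vertices with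
-- d z > 0 = e z then shows there are at least (N − λ)² / Σ (d (1 − e))² of them, and
-- Σ (d (1 − e))² is at most the denominator of the bound.  These vertices lie outside the two balls.

module Submission where

open import Data.Nat as ℕ using (ℕ; zero; suc; _+_; _*_; _∸_; _^_; _≤_; _<_; z≤n; s≤s)
import Data.Nat.Properties as ℕ
open import Data.Nat.Properties
  using (+-*-semiring; ≤-total; m≤n⇒∃[o]m+o≡n; m≤m+n; +-mono-≤; ≤-refl; *-zeroʳ; +-identityʳ; +-comm; +-suc;
         *-assoc; *-comm; *-identityʳ; m+n∸n≡m)
open import Data.Nat.Combinatorics using (_C_; nC1≡n; nCk+nC[k+1]≡[n+1]C[k+1])
open import Data.Nat.GCD using (gcd-zeroʳ)
open import Data.Nat.Solver using (module +-*-Solver)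
open import Data.Integer as ℤ using (ℤ)
import Data.Integer.Properties as ℤ
open import Data.Integer.DivMod using (div-pos-is-/ℕ; n<s[n/ℕd]*d)
open import Data.Rational using (_/_) renaming (_≤_ to _≤ℚ_)
open import Data.Rational as ℚ using (ℚ; 0ℚ; 1ℚ; ceiling; floor; ↥_; ↧_; ↧ₙ_; toℚᵘ; mkℚ; *≤*; *<*)
import Data.Rational.Properties as ℚ
import Data.Rational.Unnormalised as ℚᵘ
import Data.Rational.Unnormalised.Properties as ℚᵘ
open import Data.Fin as Fin using (Fin; toℕ)
open import Data.Fin.Properties using (suc-injective; toℕ≤pred[n]; toℕ-injective)
open import Data.List
  using (List; []; _∷_; _++_; [_]; _∷ʳ_; length; map; filter; concatMap; tabulate; reverse; initLast; _∷ʳ′_)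
open import Data.List.Properties
  using (length-++; filter-++; map-∘; map-concatMap; unfold-reverse; ∷-injectiveˡ; ∷-injectiveʳ; ++-assoc; reverse-++;
         reverse-involutive; length-reverse; ∷ʳ-injectiveˡ)
open import Data.List.Relation.Unary.All.Properties using (¬Any⇒All¬; All¬⇒¬Any)
open import Data.List.Relation.Unary.AllPairs as AllPairs using (_∷_)
open import Data.List.Relation.Unary.Any using (here; there)
import Data.List.Relation.Unary.Any.Properties as Any
open import Data.List.Relation.Unary.Linked as Linked using (Linked; []; [-]; _∷_)
open import Data.List.Relation.Unary.Unique.Propositional using (Unique)
open import Data.List.Relation.Unary.Unique.Propositional.Properties using (Unique[x∷xs]⇒x∉xs)
import Data.List.Relation.Unary.Unique.Propositional.Properties as Unique
open import Data.List.Membership.Propositional using (_∈_; _∉_)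
open import Data.List.Membership.Propositional.Properties using (∈-++⁺ˡ; ∈-++⁺ʳ; ∈-++⁻; ∈-∃++)
import Data.List.Membership.DecPropositional as DecMembership
import Data.List.Relation.Binary.Permutation.Setoid as Permutation
import Data.List.Relation.Binary.Permutation.Setoid.Properties as PermutationProperties
open import Data.Product using (Σ; ∃; ∃₂; _×_; _,_; proj₁; proj₂)
open import Data.Sum using (_⊎_; inj₁; inj₂)
open import Data.Unit using (⊤; tt)
open import Data.Empty using (⊥; ⊥-elim)
open import Function using (_∘_; id)
open import Level using (Level)
open import Relation.Nullary using (¬_; Dec; yes; no; ¬?)
open import Relation.Nullary.Decidable using (_×-dec_)
open import Relation.Unary using (Pred; Decidable)
open import Relation.Binary using (Rel; Symmetric)
open import Relation.Binary.PropositionalEquality hiding ([_])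
open import Algebra.Properties.Semiring.Sum +-*-semiring
  using (sum; sum-syntax; sum-cong-≗; sum-replicate-zero; ∑-distrib-+; ∑-comm; *-distribˡ-sum; *-distribʳ-sum)
open import Defs

open +-*-Solver using (solve; _:+_; _:*_; _:=_; con)

private variable
  a p q ℓ : Level
  A B : Set a
  P : Set p
  n : ℕ

-- Iverson brackets and finite sums

⟦_⟧ : Dec P → ℕ
⟦ yes _ ⟧ = 1
⟦ no _ ⟧  = 0

⟦⟧≤1 : (P? : Dec P) → ⟦ P? ⟧ ≤ 1
⟦⟧≤1 (yes _) = s≤s z≤n
⟦⟧≤1 (no _)  = z≤n

⟦⟧-≡1 : (P? : Dec P) → P → ⟦ P? ⟧ ≡ 1
⟦⟧-≡1 (yes _) _  = refl
⟦⟧-≡1 (no ¬p) p = ⊥-elim (¬p p)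

⟦⟧-≡0 : (P? : Dec P) → ¬ P → ⟦ P? ⟧ ≡ 0
⟦⟧-≡0 (yes p) ¬p = ⊥-elim (¬p p)
⟦⟧-≡0 (no _)  _  = refl

⟦⟧≢0⇒ : (P? : Dec P) → ¬ ⟦ P? ⟧ ≡ 0 → P
⟦⟧≢0⇒ (yes p) _ = p
⟦⟧≢0⇒ (no _)  ≢0 = ⊥-elim (≢0 refl)

⟦⟧-⇔ : {P : Set p} {Q : Set q} → (P → Q) → (Q → P) → (P? : Dec P) (Q? : Dec Q) → ⟦ P? ⟧ ≡ ⟦ Q? ⟧
⟦⟧-⇔ to from P? (yes q) = ⟦⟧-≡1 P? (from q)
⟦⟧-⇔ to from P? (no ¬q) = ⟦⟧-≡0 P? (¬q ∘ to)

⟦⟧-×-dec : {P : Set p} {Q : Set q} (P? : Dec P) (Q? : Dec Q) → ⟦ P? ×-dec Q? ⟧ ≡ ⟦ P? ⟧ * ⟦ Q? ⟧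
⟦⟧-×-dec (yes _) (yes _) = refl
⟦⟧-×-dec (yes _) (no _)  = refl
⟦⟧-×-dec (no _)  _       = refl

δ : Fin n → Fin n → ℕ
δ x y = ⟦ x Fin.≟ y ⟧

δ-sym : (x y : Fin n) → δ x y ≡ δ y x
δ-sym x y = ⟦⟧-⇔ sym sym (x Fin.≟ y) (y Fin.≟ x)

δ-suc : (x y : Fin n) → δ (Fin.suc x) (Fin.suc y) ≡ δ x y
δ-suc x y = ⟦⟧-⇔ suc-injective (cong Fin.suc) (Fin.suc x Fin.≟ Fin.suc y) (x Fin.≟ y)

sum-zero : {f : Fin n → ℕ} → (∀ i → f i ≡ 0) → sum f ≡ 0
sum-zero {n} f≡0 = trans (sum-cong-≗ f≡0) (sum-replicate-zero n)

sum-ones : ∀ n → ∑[ i < n ] 1 ≡ n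
sum-ones zero    = refl
sum-ones (suc n) = cong suc (sum-ones n)

sum-mono-≤ : {f g : Fin n → ℕ} → (∀ i → f i ≤ g i) → sum f ≤ sum g
sum-mono-≤ {zero}  f≤g = z≤n
sum-mono-≤ {suc n} f≤g = +-mono-≤ (f≤g Fin.zero) (sum-mono-≤ (f≤g ∘ Fin.suc))

sum-δ : (x : Fin n) (f : Fin n → ℕ) → ∑[ y < n ] (δ x y * f y) ≡ f x
sum-δ {suc n} Fin.zero    f = trans (cong (f Fin.zero + 0 +_) (sum-zero {n} (λ _ → refl)))
                                    (trans (+-identityʳ _) (+-identityʳ _))
sum-δ {suc n} (Fin.suc x) f = trans (sum-cong-≗ (λ y → cong (_* f (Fin.suc y)) (δ-suc x y))) (sum-δ x (f ∘ Fin.suc))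

sum-nonzero⇒ : (f : Fin n → ℕ) → ¬ sum f ≡ 0 → ∃ λ i → ¬ f i ≡ 0
sum-nonzero⇒ {zero}  f ≢0 = ⊥-elim (≢0 refl)
sum-nonzero⇒ {suc n} f ≢0 with f Fin.zero ℕ.≟ 0
... | no f₀≢0 = Fin.zero , f₀≢0
... | yes f₀≡0 with sum-nonzero⇒ (f ∘ Fin.suc) (λ rest≡0 → ≢0 (cong₂ _+_ f₀≡0 rest≡0))
...   | i , fᵢ≢0 = Fin.suc i , fᵢ≢0

sum≤1 : (f : Fin n → ℕ) → (∀ i → f i ≤ 1) → (∀ i j → ¬ f i ≡ 0 → ¬ f j ≡ 0 → i ≡ j) → sum f ≤ 1
sum≤1 {zero}  f f≤1 atMostOne = z≤n
sum≤1 {suc n} f f≤1 atMostOne with f Fin.zero ℕ.≟ 0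
... | yes f₀≡0 rewrite f₀≡0 =
  sum≤1 (f ∘ Fin.suc) (f≤1 ∘ Fin.suc) (λ i j fᵢ≢0 fⱼ≢0 → suc-injective (atMostOne _ _ fᵢ≢0 fⱼ≢0))
... | no f₀≢0 = subst (λ t → f Fin.zero + t ≤ 1) (sym (sum-zero rest≡0))
                  (subst (_≤ 1) (sym (+-identityʳ _)) (f≤1 Fin.zero))
  where
  rest≡0 : ∀ i → f (Fin.suc i) ≡ 0
  rest≡0 i with f (Fin.suc i) ℕ.≟ 0
  ... | yes fᵢ≡0 = fᵢ≡0
  ... | no fᵢ≢0 with atMostOne Fin.zero (Fin.suc i) f₀≢0 fᵢ≢0
  ...   | ()

2*m*n≤m*m+n*n : ∀ m n → 2 * m * n ≤ m * m + n * n
2*m*n≤m*m+n*n m n with ≤-total m n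
... | inj₁ m≤n with t , refl ← m≤n⇒∃[o]m+o≡n m≤n =
  subst₂ _≤_ (solve 2 (λ m t → con 2 :* m :* m :+ con 2 :* m :* t := con 2 :* m :* (m :+ t)) refl m t)
             (solve 2 (λ m t → (con 2 :* m :* m :+ con 2 :* m :* t) :+ t :* t := m :* m :+ (m :+ t) :* (m :+ t)) refl m t)
             (m≤m+n _ (t * t))
... | inj₂ n≤m with t , refl ← m≤n⇒∃[o]m+o≡n n≤m =
  subst₂ _≤_ (solve 2 (λ n t → con 2 :* n :* n :+ con 2 :* n :* t := con 2 :* (n :+ t) :* n) refl n t)
             (solve 2 (λ n t → (con 2 :* n :* n :+ con 2 :* n :* t) :+ t :* t := (n :+ t) :* (n :+ t) :+ n :* n) refl n t)
             (m≤m+n _ (t * t))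

n*n≡n+2*nC2 : ∀ n → n * n ≡ n + 2 * (n C 2)
n*n≡n+2*nC2 zero    = refl
n*n≡n+2*nC2 (suc n) = begin
  suc n * suc n                      ≡⟨ solve 1 (λ n → (con 1 :+ n) :* (con 1 :+ n) := con 1 :+ n :+ n :+ n :* n) refl n ⟩
  1 + n + n + n * n                  ≡⟨ cong (λ t → 1 + n + n + t) (n*n≡n+2*nC2 n) ⟩
  1 + n + n + (n + 2 * (n C 2))      ≡⟨ solve 2 (λ n c → con 1 :+ n :+ n :+ (n :+ con 2 :* c) := con 1 :+ n :+ con 2 :* (n :+ c)) refl n (n C 2) ⟩
  suc n + 2 * (n + n C 2)            ≡⟨ cong (λ t → suc n + 2 * (t + n C 2)) (sym (nC1≡n n)) ⟩
  suc n + 2 * (n C 1 + n C 2)        ≡⟨ cong (λ t → suc n + 2 * t) (nCk+nC[k+1]≡[n+1]C[k+1] n 1) ⟩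
  suc n + 2 * (suc n C 2)            ∎
  where open ≡-Reasoning

private
  cauchy-schwarz-step : (w b : Fin n → ℕ) → (∀ i → w i ≤ 1) → (∀ i → w i * b i ≡ b i) → ∀ x →
    2 * x * sum b ≤ sum w * (x * x) + ∑[ i < n ] (b i * b i)
  cauchy-schwarz-step {n} w b w≤1 wb≡b x =
    subst₂ _≤_ (sym (*-distribˡ-sum (2 * x) b))
               (trans (∑-distrib-+ (λ i → w i * (x * x)) (λ i → b i * b i)) (cong (_+ ∑[ i < n ] (b i * b i)) (sym (*-distribʳ-sum (x * x) w))))
               (sum-mono-≤ pointwise)
    where
    pointwise : ∀ i → 2 * x * b i ≤ w i * (x * x) + b i * b i
    pointwise i with w i | w≤1 i | wb≡b i
    ... | zero        | _      | 0≡bᵢ rewrite sym 0≡bᵢ = subst (_≤ 0) (sym (*-zeroʳ (2 * x))) z≤n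
    ... | suc zero    | _      | _ = subst (2 * x * b i ≤_) (cong (_+ b i * b i) (sym (+-identityʳ (x * x)))) (2*m*n≤m*m+n*n x (b i))
    ... | suc (suc _) | s≤s () | _

cauchy-schwarz-01 : (w b : Fin n → ℕ) → (∀ i → w i ≤ 1) → (∀ i → w i * b i ≡ b i) →
  sum b * sum b ≤ sum w * ∑[ i < n ] (b i * b i)
cauchy-schwarz-01 {zero}  w b w≤1 wb≡b = z≤n
cauchy-schwarz-01 {suc n} w b w≤1 wb≡b with w Fin.zero | w≤1 Fin.zero | wb≡b Fin.zero
... | suc (suc _) | s≤s () | _
... | zero        | _      | 0≡b₀ rewrite sym 0≡b₀ = cauchy-schwarz-01 (w ∘ Fin.suc) (b ∘ Fin.suc) (w≤1 ∘ Fin.suc) (wb≡b ∘ Fin.suc)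
... | suc zero    | _      | _ =
  subst₂ _≤_ (solve 2 (λ b₀ B → b₀ :* b₀ :+ con 2 :* b₀ :* B :+ B :* B := (b₀ :+ B) :* (b₀ :+ B)) refl b₀ Σb′)
             (solve 3 (λ b₀ W S → b₀ :* b₀ :+ (W :* (b₀ :* b₀) :+ S) :+ W :* S := (con 1 :+ W) :* (b₀ :* b₀ :+ S)) refl b₀ Σw′ Σb′²)
             (+-mono-≤ (+-mono-≤ (≤-refl {b₀ * b₀}) (cauchy-schwarz-step w′ b′ (w≤1 ∘ Fin.suc) (wb≡b ∘ Fin.suc) b₀))
                       (cauchy-schwarz-01 w′ b′ (w≤1 ∘ Fin.suc) (wb≡b ∘ Fin.suc)))
  where
  w′ b′ : Fin n → ℕ
  w′ = w ∘ Fin.suc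
  b′ = b ∘ Fin.suc
  b₀ Σb′ Σw′ Σb′² : ℕ
  b₀   = b Fin.zero
  Σb′  = sum b′
  Σw′  = sum w′
  Σb′² = ∑[ i < n ] (b′ i * b′ i)

module _ {m : ℕ} where

  m≡m*b+m*[1∸b] : ∀ {b} → b ≤ 1 → m ≡ m * b + m * (1 ℕ.∸ b)
  m≡m*b+m*[1∸b] {zero}     _ = sym (trans (cong (_+ m * 1) (*-zeroʳ m)) (ℕ.*-identityʳ m))
  m≡m*b+m*[1∸b] {suc zero} _ = sym (trans (cong (m * 1 +_) (*-zeroʳ m)) (trans (+-identityʳ _) (ℕ.*-identityʳ m)))
  m≡m*b+m*[1∸b] {suc (suc _)} (s≤s ())

  m*m≡[m*b]²+[m*[1∸b]]² : ∀ {b} → b ≤ 1 → m * m ≡ (m * b) * (m * b) + (m * (1 ℕ.∸ b)) * (m * (1 ℕ.∸ b))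
  m*m≡[m*b]²+[m*[1∸b]]² {zero}     _ rewrite *-zeroʳ m | ℕ.*-identityʳ m = refl
  m*m≡[m*b]²+[m*[1∸b]]² {suc zero} _ rewrite *-zeroʳ m | ℕ.*-identityʳ m = sym (+-identityʳ _)
  m*m≡[m*b]²+[m*[1∸b]]² {suc (suc _)} (s≤s ())

  b*[m*b]≡m*b : ∀ {b} → b ≤ 1 → b * (m * b) ≡ m * b
  b*[m*b]≡m*b {zero}     _ = sym (*-zeroʳ m)
  b*[m*b]≡m*b {suc zero} _ = +-identityʳ _
  b*[m*b]≡m*b {suc (suc _)} (s≤s ())

  m*[1∸b]≢0⇒ : ∀ {b} → b ≤ 1 → ¬ m * (1 ℕ.∸ b) ≡ 0 → ¬ m ≡ 0 × b ≡ 0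
  m*[1∸b]≢0⇒ {zero}     _ ≢0 = (λ m≡0 → ≢0 (cong (_* 1) m≡0)) , refl
  m*[1∸b]≢0⇒ {suc zero} _ ≢0 = ⊥-elim (≢0 (*-zeroʳ m))
  m*[1∸b]≢0⇒ {suc (suc _)} (s≤s ()) _

b≤1⇒b*b≡b : ∀ {b} → b ≤ 1 → b * b ≡ b
b≤1⇒b*b≡b {zero}        _        = refl
b≤1⇒b*b≡b {suc zero}    _        = refl
b≤1⇒b*b≡b {suc (suc _)} (s≤s ())

m≤m*m : ∀ m → m ≤ m * m
m≤m*m zero    = z≤n
m≤m*m (suc m) = m≤m+n (suc m) (m * suc m)

geometric-sum : ∀ q h → q * ∑[ j < h ] (suc q ℕ.^ toℕ j) + 1 ≡ suc q ℕ.^ h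
geometric-sum q zero    = cong (_+ 1) (*-zeroʳ q)
geometric-sum q (suc h) = begin
  q * (1 + ∑[ j < h ] (suc q ℕ.^ toℕ (Fin.suc j))) + 1    ≡⟨ cong (λ t → q * (1 + t) + 1) (*-distribˡ-sum {h} (suc q) (λ j → suc q ℕ.^ toℕ j)) ⟨
  q * (1 + suc q * S) + 1                                  ≡⟨ solve 2 (λ q S → q :* (con 1 :+ (con 1 :+ q) :* S) :+ con 1 := (con 1 :+ q) :* (q :* S :+ con 1)) refl q S ⟩
  suc q * (q * S + 1)                                      ≡⟨ cong (suc q *_) (geometric-sum q h) ⟩
  suc q ℕ.^ suc h                                          ∎
  where
  open ≡-Reasoning
  S : ℕ
  S = ∑[ j < h ] (suc q ℕ.^ toℕ j)

m+n≢0⇒ : ∀ m {n} → ¬ m + n ≡ 0 → ¬ m ≡ 0 ⊎ ¬ n ≡ 0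
m+n≢0⇒ zero    ≢0 = inj₂ ≢0
m+n≢0⇒ (suc m) _  = inj₁ (λ ())

m+n≤1 : ∀ {m n} → m ≤ 1 → n ≤ 1 → (¬ m ≡ 0 → ¬ n ≡ 0 → ⊥) → m + n ≤ 1
m+n≤1 {zero}          _   n≤1 _     = n≤1
m+n≤1 {suc m} {zero}  m≤1 _   _     = subst (_≤ 1) (sym (+-identityʳ (suc m))) m≤1
m+n≤1 {suc m} {suc n} _   _   apart = ⊥-elim (apart (λ ()) (λ ()))

-- Sums over all words of a given length

module _ {P : Pred A p} (P? : Decidable P) where

  length-filter-tabulate : (f : Fin n → A) → length (filter P? (tabulate f)) ≡ ∑[ i < n ] ⟦ P? (f i) ⟧
  length-filter-tabulate {n = zero}  f = refl
  length-filter-tabulate {n = suc n} f with P? (f Fin.zero)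
  ... | yes _ = cong suc (length-filter-tabulate (f ∘ Fin.suc))
  ... | no _  = length-filter-tabulate (f ∘ Fin.suc)

  length-filter-concatMap-tabulate : (g : B → List A) (f : Fin n → B) →
    length (filter P? (concatMap g (tabulate f))) ≡ ∑[ i < n ] length (filter P? (g (f i)))
  length-filter-concatMap-tabulate {n = zero}  g f = refl
  length-filter-concatMap-tabulate {n = suc n} g f = begin
    length (filter P? (g (f Fin.zero) ++ concatMap g (tabulate (f ∘ Fin.suc))))
      ≡⟨ cong length (filter-++ P? (g (f Fin.zero)) _) ⟩
    length (filter P? (g (f Fin.zero)) ++ filter P? (concatMap g (tabulate (f ∘ Fin.suc))))
      ≡⟨ length-++ (filter P? (g (f Fin.zero))) ⟩
    length (filter P? (g (f Fin.zero))) + length (filter P? (concatMap g (tabulate (f ∘ Fin.suc))))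
      ≡⟨ cong (length (filter P? (g (f Fin.zero))) +_) (length-filter-concatMap-tabulate g (f ∘ Fin.suc)) ⟩
    ∑[ i < suc n ] length (filter P? (g (f i)))
      ∎
    where open ≡-Reasoning

sumWords : ℕ → (List (Fin n) → ℕ) → ℕ
sumWords         zero    f = f []
sumWords {n = n} (suc m) f = ∑[ x < n ] sumWords m (λ r → f (x ∷ r))

length-filter-map-allLists : (G : Graph n) {P : Pred A p} (P? : Decidable P) (f : List (Fin n) → A) →
  ∀ m → length (filter P? (map f (allLists G m))) ≡ sumWords m (λ r → ⟦ P? (f r) ⟧)
length-filter-map-allLists G P? f zero with P? (f [])
... | yes _ = refl
... | no _  = refl
length-filter-map-allLists {n = n} G P? f (suc m) = begin
  length (filter P? (map f (concatMap (λ x → map (x ∷_) (allLists G m)) (tabulate (λ x → x)))))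
    ≡⟨ cong (length ∘ filter P?) (map-concatMap f (λ x → map (x ∷_) (allLists G m)) (tabulate (λ x → x))) ⟩
  length (filter P? (concatMap (λ x → map f (map (x ∷_) (allLists G m))) (tabulate (λ x → x))))
    ≡⟨ length-filter-concatMap-tabulate P? (λ x → map f (map (x ∷_) (allLists G m))) (λ x → x) ⟩
  ∑[ x < n ] length (filter P? (map f (map (x ∷_) (allLists G m))))
    ≡⟨ sum-cong-≗ {n} (λ x → cong (length ∘ filter P?) (sym (map-∘ (allLists G m)))) ⟩
  ∑[ x < n ] length (filter P? (map (λ r → f (x ∷ r)) (allLists G m)))
    ≡⟨ sum-cong-≗ {n} (λ x → length-filter-map-allLists G P? (λ r → f (x ∷ r)) m) ⟩
  sumWords (suc m) (λ r → ⟦ P? (f r) ⟧)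
    ∎
  where open ≡-Reasoning

sumWords-cong : ∀ m {f g : List (Fin n) → ℕ} → (∀ r → length r ≡ m → f r ≡ g r) → sumWords m f ≡ sumWords m g
sumWords-cong zero    f≡g = f≡g [] refl
sumWords-cong (suc m) f≡g = sum-cong-≗ (λ x → sumWords-cong m (λ r ∣r∣≡m → f≡g (x ∷ r) (cong suc ∣r∣≡m)))

sumWords-zero : ∀ m {f : List (Fin n) → ℕ} → (∀ r → length r ≡ m → f r ≡ 0) → sumWords m f ≡ 0
sumWords-zero zero    f≡0 = f≡0 [] refl
sumWords-zero (suc m) f≡0 = sum-zero (λ x → sumWords-zero m (λ r ∣r∣≡m → f≡0 (x ∷ r) (cong suc ∣r∣≡m)))

*-distribˡ-sumWords : ∀ m c (f : List (Fin n) → ℕ) → c * sumWords m f ≡ sumWords m (λ r → c * f r)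
*-distribˡ-sumWords zero    c f = refl
*-distribˡ-sumWords {n = n} (suc m) c f =
  trans (*-distribˡ-sum c (λ x → sumWords m (λ r → f (x ∷ r)))) (sum-cong-≗ {n} (λ x → *-distribˡ-sumWords m c (λ r → f (x ∷ r))))

∑-sumWords-comm : ∀ m (f : Fin n → List (Fin n) → ℕ) →
  ∑[ x < n ] sumWords m (f x) ≡ sumWords m (λ r → ∑[ x < n ] f x r)
∑-sumWords-comm zero    f = refl
∑-sumWords-comm (suc m) f = trans (∑-comm (λ x y → sumWords m (λ r → f x (y ∷ r))))
                                  (sum-cong-≗ (λ y → ∑-sumWords-comm m (λ x r → f x (y ∷ r))))

sumWords-++ : ∀ m₁ m₂ (f : List (Fin n) → ℕ) →
  sumWords (m₁ + m₂) f ≡ sumWords m₁ (λ r₁ → sumWords m₂ (λ r₂ → f (r₁ ++ r₂)))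
sumWords-++ zero     m₂ f = refl
sumWords-++ (suc m₁) m₂ f = sum-cong-≗ (λ x → sumWords-++ m₁ m₂ (λ r → f (x ∷ r)))

sumWords-∷ʳ : ∀ m (f : List (Fin n) → ℕ) → sumWords (suc m) f ≡ sumWords m (λ r → ∑[ x < n ] f (r ∷ʳ x))
sumWords-∷ʳ m f = trans (cong (λ t → sumWords t f) (+-comm 1 m)) (sumWords-++ m 1 f)

sumWords-reverse : ∀ m (f : List (Fin n) → ℕ) → sumWords m (f ∘ reverse) ≡ sumWords m f
sumWords-reverse         zero    f = refl
sumWords-reverse {n = n} (suc m) f = begin
  ∑[ x < n ] sumWords m (λ r → f (reverse (x ∷ r)))   ≡⟨ sum-cong-≗ (λ x → sumWords-cong m (λ r _ → cong f (unfold-reverse x r))) ⟩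
  ∑[ x < n ] sumWords m (λ r → f (reverse r ∷ʳ x))    ≡⟨ sum-cong-≗ (λ x → sumWords-reverse m (λ r → f (r ∷ʳ x))) ⟩
  ∑[ x < n ] sumWords m (λ r → f (r ∷ʳ x))            ≡⟨ ∑-sumWords-comm m (λ x r → f (r ∷ʳ x)) ⟩
  sumWords m (λ r → ∑[ x < n ] f (r ∷ʳ x))            ≡⟨ sumWords-∷ʳ m f ⟨
  sumWords (suc m) f                                   ∎
  where open ≡-Reasoning

sumWords≢0⇒ : ∀ m (f : List (Fin n) → ℕ) → ¬ sumWords m f ≡ 0 → ∃ λ r → length r ≡ m × ¬ f r ≡ 0
sumWords≢0⇒ zero    f ≢0 = [] , refl , ≢0
sumWords≢0⇒ (suc m) f ≢0 with x , ≢0ₓ ← sum-nonzero⇒ _ ≢0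
                         with r , ∣r∣≡m , fxr≢0 ← sumWords≢0⇒ m (λ r → f (x ∷ r)) ≢0ₓ
                         = x ∷ r , cong suc ∣r∣≡m , fxr≢0

sumWords≤1 : ∀ m (f : List (Fin n) → ℕ) → (∀ r → f r ≤ 1) →
  (∀ r r′ → length r ≡ m → length r′ ≡ m → ¬ f r ≡ 0 → ¬ f r′ ≡ 0 → r ≡ r′) → sumWords m f ≤ 1
sumWords≤1 zero    f f≤1 atMostOne = f≤1 []
sumWords≤1 (suc m) f f≤1 atMostOne =
  sum≤1 _ (λ x → sumWords≤1 m (λ r → f (x ∷ r)) (λ r → f≤1 (x ∷ r)) (λ r r′ ∣r∣ ∣r′∣ fr fr′ →
                   ∷-injectiveʳ (atMostOne (x ∷ r) (x ∷ r′) (cong suc ∣r∣) (cong suc ∣r′∣) fr fr′)))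
          sameHead
  where
  sameHead : ∀ x y → ¬ sumWords m (λ r → f (x ∷ r)) ≡ 0 → ¬ sumWords m (λ r → f (y ∷ r)) ≡ 0 → x ≡ y
  sameHead x y ≢0ₓ ≢0ᵧ with r , ∣r∣ , fxr ← sumWords≢0⇒ m _ ≢0ₓ | r′ , ∣r′∣ , fyr′ ← sumWords≢0⇒ m _ ≢0ᵧ =
    ∷-injectiveˡ (atMostOne (x ∷ r) (y ∷ r′) (cong suc ∣r∣) (cong suc ∣r′∣) fxr fyr′)

-- Duplicate-free and linked lists

module _ {x : A} {xs : List A} where

  Unique-∷ : x ∉ xs → Unique xs → Unique (x ∷ xs)
  Unique-∷ x∉xs xs! = ¬Any⇒All¬ xs x∉xs ∷ xs!

Unique-++⁻ˡ : ∀ (xs : List A) {ys} → Unique (xs ++ ys) → Unique xs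
Unique-++⁻ˡ []       _          = AllPairs.[]
Unique-++⁻ˡ (x ∷ xs) (x∉ ∷ xs!) = Unique-∷ (λ x∈xs → All¬⇒¬Any x∉ (∈-++⁺ˡ x∈xs)) (Unique-++⁻ˡ xs xs!)

Unique-++⁻ʳ : ∀ (xs : List A) {ys} → Unique (xs ++ ys) → Unique ys
Unique-++⁻ʳ []       ys!       = ys!
Unique-++⁻ʳ (_ ∷ xs) (_ ∷ xs!) = Unique-++⁻ʳ xs xs!

Unique-++⇒disjoint : ∀ (xs : List A) {ys z} → Unique (xs ++ ys) → z ∈ xs → z ∈ ys → ⊥
Unique-++⇒disjoint (x ∷ xs) (x∉ ∷ _)  (here refl)  z∈ys = All¬⇒¬Any x∉ (∈-++⁺ʳ xs z∈ys)
Unique-++⇒disjoint (x ∷ xs) (_ ∷ xs!) (there z∈xs) z∈ys = Unique-++⇒disjoint xs xs! z∈xs z∈ys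

Unique-reverse : (xs : List A) → Unique xs → Unique (reverse xs)
Unique-reverse {A = A} xs = Unique-resp-↭ (↭-sym (↭-reverse xs))
  where
  open Permutation (setoid A) using (↭-sym)
  open PermutationProperties (setoid A) using (Unique-resp-↭; ↭-reverse)

module _ {R : Rel A ℓ} where

  Linked-++⁻ˡ : ∀ xs {ys} → Linked R (xs ++ ys) → Linked R xs
  Linked-++⁻ˡ []           _          = []
  Linked-++⁻ˡ (x ∷ [])     _          = [-]
  Linked-++⁻ˡ (x ∷ y ∷ xs) (Rxy ∷ Rs) = Rxy ∷ Linked-++⁻ˡ (y ∷ xs) Rs

  Linked-++⁻ʳ : ∀ xs {ys} → Linked R (xs ++ ys) → Linked R ys
  Linked-++⁻ʳ []           Rs         = Rs
  Linked-++⁻ʳ (x ∷ [])     Rs         = Linked.tail Rs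
  Linked-++⁻ʳ (x ∷ y ∷ xs) (_ ∷ Rs)   = Linked-++⁻ʳ (y ∷ xs) Rs

  Linked-join : ∀ xs {x ys} → Linked R (xs ∷ʳ x) → Linked R (x ∷ ys) → Linked R (xs ++ x ∷ ys)
  Linked-join []           _          Rys = Rys
  Linked-join (_ ∷ [])     (Rxy ∷ _)  Rys = Rxy ∷ Rys
  Linked-join (_ ∷ y ∷ xs) (Rxy ∷ Rs) Rys = Rxy ∷ Linked-join (y ∷ xs) Rs Rys

  Linked-reverse : Symmetric R → ∀ xs → Linked R xs → Linked R (reverse xs)
  Linked-reverse R-sym []           _          = []
  Linked-reverse R-sym (x ∷ [])     _          = [-]
  Linked-reverse R-sym (x ∷ y ∷ xs) (Rxy ∷ Rs) = subst (Linked R) (sym reverse-xyxs)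
    (Linked-join (reverse xs) (subst (Linked R) (unfold-reverse y xs) (Linked-reverse R-sym (y ∷ xs) Rs)) (R-sym Rxy ∷ [-]))
    where
    reverse-xyxs : reverse (x ∷ y ∷ xs) ≡ reverse xs ++ y ∷ x ∷ []
    reverse-xyxs = trans (unfold-reverse x (y ∷ xs))
                         (trans (cong (_∷ʳ x) (unfold-reverse y xs)) (++-assoc (reverse xs) [ y ] [ x ]))

  Linked-∷ʳ⁻ : ∀ xs {x ys} → Linked R (xs ++ x ∷ ys) → Linked R (xs ∷ʳ x)
  Linked-∷ʳ⁻ xs {x} {ys} Rs = Linked-++⁻ˡ (xs ∷ʳ x) (subst (Linked R) (sym (++-assoc xs [ x ] ys)) Rs)

-- Non-backtracking walks and girth

module Walks {n : ℕ} (G : Graph n) where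

  open Graph G renaming (sym to Adj-sym)
  open DecMembership (Fin._≟_ {n}) using (_∈?_)

  V : Set
  V = Fin n

  Forward : V → V → V → Set
  Forward p c y = Adj c y × ¬ y ≡ p

  forward? : ∀ p c y → Dec (Forward p c y)
  forward? p c y = adj? c y ×-dec ¬? (y Fin.≟ p)

  -- c ∷ r is a walk that never immediately reverses an edge, and whose first step does not return to p
  NBWalk : V → V → List V → Set
  NBWalk p c []      = ⊤
  NBWalk p c (y ∷ r) = Forward p c y × NBWalk c y r

  nbWalk? : ∀ p c r → Dec (NBWalk p c r)
  nbWalk? p c []      = yes tt
  nbWalk? p c (y ∷ r) = forward? p c y ×-dec nbWalk? c y r

  walkEnd : V → List V → V
  walkEnd c []      = c
  walkEnd c (y ∷ r) = walkEnd y r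

  walkEnd-∈ : ∀ c r → walkEnd c r ∈ c ∷ r
  walkEnd-∈ c []      = here refl
  walkEnd-∈ c (y ∷ r) = there (walkEnd-∈ y r)

  walkEnd-∷ʳ : ∀ c r z → walkEnd c (r ∷ʳ z) ≡ z
  walkEnd-∷ʳ c []      z = refl
  walkEnd-∷ʳ c (y ∷ r) z = walkEnd-∷ʳ y r z

  NBWalk⇒Linked : ∀ p c r → NBWalk p c r → Linked Adj (c ∷ r)
  NBWalk⇒Linked p c []      _              = [-]
  NBWalk⇒Linked p c (y ∷ r) ((c~y , _) , w) = c~y ∷ NBWalk⇒Linked c y r w

  NBWalk-++⁻ˡ : ∀ p c r s → NBWalk p c (r ++ s) → NBWalk p c r
  NBWalk-++⁻ˡ p c []      s _            = tt
  NBWalk-++⁻ˡ p c (y ∷ r) s (step , w) = step , NBWalk-++⁻ˡ c y r s w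

  IsPath : List V → Set
  IsPath w = Unique w × Linked Adj w

  path⇒NBWalk : ∀ p c r → Unique (p ∷ c ∷ r) → Linked Adj (c ∷ r) → NBWalk p c r
  path⇒NBWalk p c []      _        _           = tt
  path⇒NBWalk p c (y ∷ r) (p∉ ∷ w!) (c~y ∷ w~) =
    (c~y , λ y≡p → Unique[x∷xs]⇒x∉xs (p∉ ∷ w!) (there (here (sym y≡p)))) , path⇒NBWalk c y r w! w~

  firstCommon : ∀ {z} (xs ys : List V) → z ∈ xs → z ∈ ys →
    ∃₂ λ as bs → ∃ λ x → xs ≡ as ++ x ∷ bs × x ∈ ys × (∀ {a} → a ∈ as → a ∉ ys)
  firstCommon (y ∷ xs) ys z∈xs z∈ys with y ∈? ys | z∈xs
  ... | yes y∈ys | _           = [] , xs , y , refl , y∈ys , λ ()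
  ... | no y∉ys  | here refl   = ⊥-elim (y∉ys z∈ys)
  ... | no y∉ys  | there z∈xs′ with as , bs , x , xs≡ , x∈ys , as∉ys ← firstCommon xs ys z∈xs′ z∈ys =
    y ∷ as , bs , x , cong (y ∷_) xs≡ , x∈ys , λ { (here refl) → y∉ys ; (there a∈as) → as∉ys a∈as }

  -- Two paths from c with different first steps, split at the first vertex x of w₁ that also lies on w₂
  record Fork (c : V) (w₁ w₂ : List V) : Set where
    field
      as bs cs ds : List V
      x           : V
      split₁      : w₁ ≡ as ++ x ∷ bs
      split₂      : w₂ ≡ cs ++ x ∷ ds
      nontrivial  : 1 ≤ length as + length cs
      isCycle     : IsCycleList G (c ∷ as ++ x ∷ reverse cs)

    cycle : List V
    cycle = c ∷ as ++ x ∷ reverse cs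

    length-cycle : length cycle ≡ 2 + (length as + length cs)
    length-cycle = cong suc (trans (length-++ as) (trans (+-suc (length as) _)
                     (cong (λ t → suc (length as + t)) (length-reverse cs))))

    3≤length-cycle : 3 ≤ length cycle
    3≤length-cycle = subst (3 ≤_) (sym length-cycle) (s≤s (s≤s nontrivial))

    length-split : length w₁ + length w₂ ≡ length cycle + (length bs + length ds)
    length-split = begin
      length w₁ + length w₂                                   ≡⟨ cong₂ _+_ (trans (cong length split₁) (length-++ as))
                                                                             (trans (cong length split₂) (length-++ cs)) ⟩
      (length as + suc (length bs)) + (length cs + suc (length ds))
        ≡⟨ solve 4 (λ a b c d → (a :+ (con 1 :+ b)) :+ (c :+ (con 1 :+ d)) := con 2 :+ (a :+ c) :+ (b :+ d)) refl
                   (length as) (length bs) (length cs) (length ds) ⟩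
      2 + (length as + length cs) + (length bs + length ds)  ≡⟨ cong (_+ (length bs + length ds)) length-cycle ⟨
      length cycle + (length bs + length ds)                 ∎
      where open ≡-Reasoning

  forkCycle : ∀ c as x bs cs ds → IsPath (c ∷ as ++ x ∷ bs) → IsPath (c ∷ cs ++ x ∷ ds) →
              (∀ {a} → a ∈ as → a ∉ cs ++ x ∷ ds) → IsCycleList G (c ∷ as ++ x ∷ reverse cs)
  forkCycle c as x bs cs ds (w₁! , w₁~) (w₂! , w₂~) as∉w₂ = Unique-∷ c∉ body! , linked
    where
    c∉ : c ∉ as ++ x ∷ reverse cs
    c∉ c∈ with ∈-++⁻ as c∈
    ... | inj₁ c∈as          = Unique[x∷xs]⇒x∉xs w₁! (∈-++⁺ˡ c∈as)
    ... | inj₂ (here c≡x)    = Unique[x∷xs]⇒x∉xs w₁! (∈-++⁺ʳ as (here c≡x))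
    ... | inj₂ (there c∈cs′) = Unique[x∷xs]⇒x∉xs w₂! (∈-++⁺ˡ (Any.reverse⁻ {xs = cs} c∈cs′))
    x∉cs : x ∉ cs
    x∉cs x∈cs = Unique-++⇒disjoint cs (AllPairs.tail w₂!) x∈cs (here refl)
    body! : Unique (as ++ x ∷ reverse cs)
    body! = Unique.++⁺ (Unique-++⁻ˡ as (AllPairs.tail w₁!))
                       (Unique-∷ (λ x∈cs′ → x∉cs (Any.reverse⁻ x∈cs′)) (Unique-reverse cs (Unique-++⁻ˡ cs (AllPairs.tail w₂!))))
                       λ { (a∈as , here refl)    → as∉w₂ a∈as (∈-++⁺ʳ cs (here refl))
                         ; (a∈as , there a∈cs′) → as∉w₂ a∈as (∈-++⁺ˡ (Any.reverse⁻ {xs = cs} a∈cs′)) }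
    back : Linked Adj (x ∷ reverse cs ∷ʳ c)
    back = subst (Linked Adj) (trans (reverse-++ (c ∷ cs) [ x ]) (cong (x ∷_) (unfold-reverse c cs)))
                 (Linked-reverse Adj-sym ((c ∷ cs) ∷ʳ x) (Linked-∷ʳ⁻ (c ∷ cs) w₂~))
    linked : Linked Adj ((c ∷ as ++ x ∷ reverse cs) ++ [ c ])
    linked = subst (Linked Adj) (cong (c ∷_) (sym (++-assoc as (x ∷ reverse cs) [ c ])))
                   (Linked-join (c ∷ as) (Linked-∷ʳ⁻ (c ∷ as) w₁~) back)

  private
    fork-nontrivial : ∀ {y₁ y₂ x : V} {r₁ r₂} as bs cs ds → ¬ y₁ ≡ y₂ →
      y₁ ∷ r₁ ≡ as ++ x ∷ bs → y₂ ∷ r₂ ≡ cs ++ x ∷ ds → 1 ≤ length as + length cs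
    fork-nontrivial []      _ []      _ y₁≢y₂ refl refl = ⊥-elim (y₁≢y₂ refl)
    fork-nontrivial (_ ∷ _) _ _       _ _     _    _    = s≤s z≤n
    fork-nontrivial []      _ (_ ∷ _) _ _     _    _    = s≤s z≤n

  fork : ∀ c y₁ r₁ y₂ r₂ → ¬ y₁ ≡ y₂ → IsPath (c ∷ y₁ ∷ r₁) → IsPath (c ∷ y₂ ∷ r₂) →
         walkEnd y₁ r₁ ≡ walkEnd y₂ r₂ → Fork c (y₁ ∷ r₁) (y₂ ∷ r₂)
  fork c y₁ r₁ y₂ r₂ y₁≢y₂ path₁ path₂ sameEnd
    with as , bs , x , w₁≡ , x∈w₂ , as∉w₂ ← firstCommon (y₁ ∷ r₁) (y₂ ∷ r₂) (walkEnd-∈ y₁ r₁)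
                                               (subst (_∈ y₂ ∷ r₂) (sym sameEnd) (walkEnd-∈ y₂ r₂))
    with cs , ds , w₂≡ ← ∈-∃++ x∈w₂ = record
      { as = as ; bs = bs ; cs = cs ; ds = ds ; x = x ; split₁ = w₁≡ ; split₂ = w₂≡
      ; nontrivial = fork-nontrivial as bs cs ds y₁≢y₂ w₁≡ w₂≡
      ; isCycle = forkCycle c as x bs cs ds (subst (λ w → IsPath (c ∷ w)) w₁≡ path₁)
                    (subst (λ w → IsPath (c ∷ w)) w₂≡ path₂) (λ a∈as → subst (_ ∉_) w₂≡ (as∉w₂ a∈as))
      }

module Girth {n : ℕ} (G : Graph n) (g : ℕ) (noShortCycle : ∀ ℓ → ℓ < g → ¬ HasCycleOfLength G ℓ) where

  open Graph G renaming (sym to Adj-sym)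
  open Walks G

  cycle-≥g : ∀ {w} → IsCycleList G w → 3 ≤ length w → ¬ length w < g
  cycle-≥g {w} cyc 3≤∣w∣ ∣w∣<g = noShortCycle (length w) ∣w∣<g (3≤∣w∣ , w , refl , cyc)

  nbWalk⇒unique : ∀ p c r → Adj p c → NBWalk p c r → 2 + length r ≤ g → Unique (p ∷ c ∷ r)
  nbWalk⇒unique p c []      p~c _ _ = Unique-∷ (λ { (here refl) → irrefl p~c }) (Unique-∷ (λ ()) AllPairs.[])
  nbWalk⇒unique p c (y ∷ r) p~c walk@((c~y , y≢p) , walk′) ∣walk∣≤g = Unique-∷ p∉c∷y∷r c∷y∷r!
    where
    c∷y∷r! : Unique (c ∷ y ∷ r)
    c∷y∷r! = nbWalk⇒unique c y r c~y walk′ (ℕ.≤-trans (ℕ.n≤1+n _) ∣walk∣≤g)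

    return⇒⊥ : ∀ ys zs → y ∷ r ≡ ys ++ p ∷ zs → ⊥
    return⇒⊥ []           zs y∷r≡ = y≢p (∷-injectiveˡ y∷r≡)
    return⇒⊥ ys@(_ ∷ _)   zs y∷r≡ =
      cycle-≥g (Unique-∷ p∉c∷ys c∷ys! , p~c ∷ Linked-∷ʳ⁻ (c ∷ ys) c∷ys~) (s≤s (s≤s (s≤s z≤n))) ∣cycle∣<g
      where
      split! : Unique (c ∷ ys ++ p ∷ zs)
      split! = subst (λ t → Unique (c ∷ t)) y∷r≡ c∷y∷r!
      c∷ys! : Unique (c ∷ ys)
      c∷ys! = Unique-++⁻ˡ (c ∷ ys) split!
      p∉c∷ys : p ∉ c ∷ ys
      p∉c∷ys (here refl)  = irrefl p~c
      p∉c∷ys (there p∈ys) = Unique-++⇒disjoint ys (AllPairs.tail split!) p∈ys (here refl)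
      c∷ys~ : Linked Adj (c ∷ ys ++ p ∷ zs)
      c∷ys~ = subst (λ t → Linked Adj (c ∷ t)) y∷r≡ (NBWalk⇒Linked p c (y ∷ r) walk)
      ∣ys∣≤∣r∣ : length ys ≤ length r
      ∣ys∣≤∣r∣ = ℕ.≤-pred (subst (length ys <_) (sym (cong length y∷r≡))
                   (subst (length ys <_) (sym (length-++ ys)) (ℕ.m<m+n (length ys) (s≤s z≤n))))
      ∣cycle∣<g : 2 + length ys < g
      ∣cycle∣<g = ℕ.<-≤-trans (s≤s (s≤s (s≤s ∣ys∣≤∣r∣))) ∣walk∣≤g

    p∉c∷y∷r : p ∉ c ∷ y ∷ r
    p∉c∷y∷r (here refl)     = irrefl p~c
    p∉c∷y∷r (there p∈y∷r) with ys , zs , y∷r≡ ← ∈-∃++ p∈y∷r = return⇒⊥ ys zs y∷r≡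

  nbWalk⇒path : ∀ p c r → Adj p c → NBWalk p c r → 2 + length r ≤ g → IsPath (c ∷ r)
  nbWalk⇒path p c r p~c walk ∣walk∣≤g = AllPairs.tail (nbWalk⇒unique p c r p~c walk ∣walk∣≤g) , NBWalk⇒Linked p c r walk

  paths-unique : ∀ c r₁ r₂ → IsPath (c ∷ r₁) → IsPath (c ∷ r₂) → walkEnd c r₁ ≡ walkEnd c r₂ →
                 length r₁ + length r₂ < g → r₁ ≡ r₂
  paths-unique c []        []        _  _  _       _ = refl
  paths-unique c []        (y ∷ r₂)  _  (path₂! , _) sameEnd _ =
    ⊥-elim (Unique[x∷xs]⇒x∉xs path₂! (subst (_∈ y ∷ r₂) (sym sameEnd) (walkEnd-∈ y r₂)))
  paths-unique c (y ∷ r₁) []         (path₁! , _) _ sameEnd _ =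
    ⊥-elim (Unique[x∷xs]⇒x∉xs path₁! (subst (_∈ y ∷ r₁) sameEnd (walkEnd-∈ y r₁)))
  paths-unique c (y₁ ∷ r₁) (y₂ ∷ r₂) path₁@(path₁! , path₁~) path₂@(path₂! , path₂~) sameEnd ∣r₁∣+∣r₂∣<g with y₁ Fin.≟ y₂
  ... | yes refl = cong (y₁ ∷_) (paths-unique y₁ r₁ r₂ (AllPairs.tail path₁! , Linked.tail path₁~)
                                  (AllPairs.tail path₂! , Linked.tail path₂~) sameEnd
                                  (ℕ.≤-<-trans (ℕ.+-mono-≤ (ℕ.n≤1+n (length r₁)) (ℕ.n≤1+n (length r₂))) ∣r₁∣+∣r₂∣<g))
  ... | no y₁≢y₂ = ⊥-elim (cycle-≥g isCycle 3≤length-cycle (ℕ.≤-<-trans ∣cycle∣≤ ∣r₁∣+∣r₂∣<g))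
    where
    open Fork (fork c y₁ r₁ y₂ r₂ y₁≢y₂ path₁ path₂ sameEnd)
    ∣cycle∣≤ : length cycle ≤ length (y₁ ∷ r₁) + length (y₂ ∷ r₂)
    ∣cycle∣≤ = subst (length cycle ≤_) (sym length-split) (ℕ.m≤m+n _ _)

  private
    bothEmpty⊎nonempty : (xs ys : List V) → (xs ≡ [] × ys ≡ []) ⊎ 1 ≤ length xs + length ys
    bothEmpty⊎nonempty []      []      = inj₁ (refl , refl)
    bothEmpty⊎nonempty []      (_ ∷ _) = inj₂ (s≤s z≤n)
    bothEmpty⊎nonempty (_ ∷ _) _       = inj₂ (s≤s z≤n)

  fork-≤g : ∀ c y₁ r₁ y₂ r₂ → ¬ y₁ ≡ y₂ → IsPath (c ∷ y₁ ∷ r₁) → IsPath (c ∷ y₂ ∷ r₂) →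
            walkEnd y₁ r₁ ≡ walkEnd y₂ r₂ → length (y₁ ∷ r₁) + length (y₂ ∷ r₂) ≤ g →
            Σ (Fork c (y₁ ∷ r₁) (y₂ ∷ r₂)) λ F → Fork.bs F ≡ [] × Fork.ds F ≡ []
  fork-≤g c y₁ r₁ y₂ r₂ y₁≢y₂ path₁ path₂ sameEnd ∣w₁∣+∣w₂∣≤g with bothEmpty⊎nonempty bs ds
    where open Fork (fork c y₁ r₁ y₂ r₂ y₁≢y₂ path₁ path₂ sameEnd)
  ... | inj₁ bs,ds≡[] = fork c y₁ r₁ y₂ r₂ y₁≢y₂ path₁ path₂ sameEnd , bs,ds≡[]
  ... | inj₂ 1≤∣bs∣+∣ds∣ = ⊥-elim (cycle-≥g isCycle 3≤length-cycle
                            (ℕ.<-≤-trans (subst (length cycle <_) (sym length-split) (ℕ.m<m+n _ 1≤∣bs∣+∣ds∣)) ∣w₁∣+∣w₂∣≤g))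
    where open Fork (fork c y₁ r₁ y₂ r₂ y₁≢y₂ path₁ path₂ sameEnd)

-- Counting non-backtracking walks

module Counting {n : ℕ} (G : Graph n) where

  open Graph G renaming (sym to Adj-sym)
  open Walks G

  walkSum : V → V → ℕ → (V → ℕ) → ℕ
  walkSum p c m f = sumWords m (λ r → ⟦ nbWalk? p c r ⟧ * f (walkEnd c r))

  walksTo : V → V → ℕ → V → ℕ
  walksTo p c m z = walkSum p c m (λ x → δ x z)

  #walks : V → V → ℕ → ℕ
  #walks p c m = walkSum p c m (λ _ → 1)

  walkSum-suc : ∀ p c m f → walkSum p c (suc m) f ≡ ∑[ y < n ] (⟦ forward? p c y ⟧ * walkSum c y m f)
  walkSum-suc p c m f = sum-cong-≗ {n} λ y → begin
    sumWords m (λ r → ⟦ forward? p c y ×-dec nbWalk? c y r ⟧ * f (walkEnd y r))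
      ≡⟨ sumWords-cong m (λ r _ → trans (cong (_* f (walkEnd y r)) (⟦⟧-×-dec (forward? p c y) (nbWalk? c y r)))
                                         (*-assoc ⟦ forward? p c y ⟧ _ _)) ⟩
    sumWords m (λ r → ⟦ forward? p c y ⟧ * (⟦ nbWalk? c y r ⟧ * f (walkEnd y r)))
      ≡⟨ *-distribˡ-sumWords m ⟦ forward? p c y ⟧ _ ⟨
    ⟦ forward? p c y ⟧ * walkSum c y m f
      ∎
    where open ≡-Reasoning

  walkSum≡∑walksTo : ∀ p c m f → walkSum p c m f ≡ ∑[ z < n ] (walksTo p c m z * f z)
  walkSum≡∑walksTo p c m f = begin
    sumWords m (λ r → ⟦ nbWalk? p c r ⟧ * f (walkEnd c r))
      ≡⟨ sumWords-cong m (λ r _ → cong (⟦ nbWalk? p c r ⟧ *_) (sum-δ (walkEnd c r) f)) ⟨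
    sumWords m (λ r → ⟦ nbWalk? p c r ⟧ * ∑[ z < n ] (δ (walkEnd c r) z * f z))
      ≡⟨ sumWords-cong m (λ r _ → trans (*-distribˡ-sum {n} ⟦ nbWalk? p c r ⟧ _)
                                         (sum-cong-≗ {n} λ z → sym (*-assoc ⟦ nbWalk? p c r ⟧ _ (f z)))) ⟩
    sumWords m (λ r → ∑[ z < n ] (⟦ nbWalk? p c r ⟧ * δ (walkEnd c r) z * f z))
      ≡⟨ ∑-sumWords-comm m _ ⟨
    ∑[ z < n ] sumWords m (λ r → ⟦ nbWalk? p c r ⟧ * δ (walkEnd c r) z * f z)
      ≡⟨ sum-cong-≗ {n} (λ z → trans (*-comm _ (f z))
                                 (trans (*-distribˡ-sumWords m (f z) _) (sumWords-cong m (λ r _ → *-comm (f z) _)))) ⟨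
    ∑[ z < n ] (walksTo p c m z * f z)
      ∎
    where open ≡-Reasoning

  ∑walksTo≡#walks : ∀ p c m → ∑[ z < n ] walksTo p c m z ≡ #walks p c m
  ∑walksTo≡#walks p c m = trans (sum-cong-≗ {n} (λ z → sym (*-identityʳ _))) (sym (walkSum≡∑walksTo p c m (λ _ → 1)))

  walksTo≡∑⟦end⟧ : ∀ p c m z → walksTo p c m z ≡ sumWords m (λ r → ⟦ nbWalk? p c r ×-dec walkEnd c r Fin.≟ z ⟧)
  walksTo≡∑⟦end⟧ p c m z = sumWords-cong m (λ r _ → sym (⟦⟧-×-dec (nbWalk? p c r) (walkEnd c r Fin.≟ z)))

  walksTo≢0⇒ : ∀ p c m z → ¬ walksTo p c m z ≡ 0 → ∃ λ r → length r ≡ m × NBWalk p c r × walkEnd c r ≡ z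
  walksTo≢0⇒ p c m z ≢0 with r , ∣r∣≡m , ⟦⟧≢0 ← sumWords≢0⇒ m _ (λ ≡0 → ≢0 (trans (walksTo≡∑⟦end⟧ p c m z) ≡0))
    = r , ∣r∣≡m , ⟦⟧≢0⇒ (nbWalk? p c r ×-dec walkEnd c r Fin.≟ z) ⟦⟧≢0

  walksTo-∷ʳ : ∀ p c m z → walksTo p c (suc m) z ≡ sumWords m (λ r → ⟦ nbWalk? p c (r ∷ʳ z) ⟧)
  walksTo-∷ʳ p c m z = trans (sumWords-∷ʳ m (λ r → ⟦ nbWalk? p c r ⟧ * δ (walkEnd c r) z)) (sumWords-cong m λ r _ → trans
    (sum-cong-≗ {n} λ x → trans (cong (λ e → ⟦ nbWalk? p c (r ∷ʳ x) ⟧ * δ e z) (walkEnd-∷ʳ c r x))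
                            (trans (*-comm _ (δ x z)) (cong (_* ⟦ nbWalk? p c (r ∷ʳ x) ⟧) (δ-sym x z))))
    (sum-δ z (λ x → ⟦ nbWalk? p c (r ∷ʳ x) ⟧)))

  degree≡∑⟦adj⟧ : ∀ c → degree G c ≡ ∑[ y < n ] ⟦ adj? c y ⟧
  degree≡∑⟦adj⟧ c = length-filter-tabulate (adj? c) id

  ⟦adj⟧≡⟦forward⟧+δ : ∀ {p c} → Adj c p → ∀ y → ⟦ adj? c y ⟧ ≡ ⟦ forward? p c y ⟧ + δ y p
  ⟦adj⟧≡⟦forward⟧+δ {p} {c} c~p y with y Fin.≟ p | adj? c y
  ... | yes refl | yes _    = refl
  ... | yes refl | no ¬c~p = ⊥-elim (¬c~p c~p)
  ... | no _     | yes _    = refl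
  ... | no _     | no _     = refl

  forward-*-cong : ∀ {p c y} a b → (Forward p c y → a ≡ b) → ⟦ forward? p c y ⟧ * a ≡ ⟦ forward? p c y ⟧ * b
  forward-*-cong {p} {c} {y} a b a≡b with forward? p c y
  ... | yes step = cong (_+ 0) (a≡b step)
  ... | no _     = refl

  module _ {k : ℕ} (regular : Regular G k) where

    ∑⟦forward⟧≡k∸1 : ∀ {p c} → Adj c p → ∑[ y < n ] ⟦ forward? p c y ⟧ ≡ k ∸ 1
    ∑⟦forward⟧≡k∸1 {p} {c} c~p = begin
      ∑[ y < n ] ⟦ forward? p c y ⟧                       ≡⟨ m+n∸n≡m _ 1 ⟨
      ∑[ y < n ] ⟦ forward? p c y ⟧ + 1 ∸ 1               ≡⟨ cong (λ t → ∑[ y < n ] ⟦ forward? p c y ⟧ + t ∸ 1) (sum-δ p (λ _ → 1)) ⟨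
      ∑[ y < n ] ⟦ forward? p c y ⟧ + ∑[ y < n ] (δ p y * 1) ∸ 1
        ≡⟨ cong (_∸ 1) (∑-distrib-+ (λ y → ⟦ forward? p c y ⟧) _) ⟨
      ∑[ y < n ] (⟦ forward? p c y ⟧ + δ p y * 1) ∸ 1
        ≡⟨ cong (_∸ 1) (sum-cong-≗ {n} λ y → trans (cong (⟦ forward? p c y ⟧ +_) (trans (*-identityʳ _) (δ-sym p y)))
                                                (sym (⟦adj⟧≡⟦forward⟧+δ c~p y))) ⟩
      ∑[ y < n ] ⟦ adj? c y ⟧ ∸ 1                         ≡⟨ cong (_∸ 1) (trans (sym (degree≡∑⟦adj⟧ c)) (regular c)) ⟩
      k ∸ 1                                               ∎
      where open ≡-Reasoning

    #walks≡ : ∀ {p c} m → Adj c p → #walks p c m ≡ (k ∸ 1) ^ m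
    #walks≡ zero    c~p = refl
    #walks≡ {p} {c} (suc m) c~p = begin
      #walks p c (suc m)                                    ≡⟨ walkSum-suc p c m (λ _ → 1) ⟩
      ∑[ y < n ] (⟦ forward? p c y ⟧ * #walks c y m)         ≡⟨ sum-cong-≗ {n} (λ y → forward-*-cong _ _ λ (c~y , _) → #walks≡ m (Adj-sym c~y)) ⟩
      ∑[ y < n ] (⟦ forward? p c y ⟧ * (k ∸ 1) ^ m)          ≡⟨ *-distribʳ-sum {n} ((k ∸ 1) ^ m) _ ⟨
      ∑[ y < n ] ⟦ forward? p c y ⟧ * (k ∸ 1) ^ m            ≡⟨ cong (_* (k ∸ 1) ^ m) (∑⟦forward⟧≡k∸1 c~p) ⟩
      (k ∸ 1) ^ suc m                                        ∎
      where open ≡-Reasoning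

-- h′ + 1 is the h of the informal statement: the girth is 2 (h′ + 1)
module EvenGirth {n : ℕ} (G : Graph n) (h′ : ℕ) (1≤h′ : 1 ≤ h′)
                 (noShortCycle : ∀ ℓ → ℓ < 2 * suc h′ → ¬ HasCycleOfLength G ℓ) where

  open Graph G renaming (sym to Adj-sym)
  open Walks G
  open Counting G
  open Girth G (2 * suc h′) noShortCycle

  g : ℕ
  g = 2 * suc h′

  g≡ : g ≡ 2 + (h′ + h′)
  g≡ = solve 1 (λ h → con 2 :* (con 1 :+ h) := con 2 :+ (h :+ h)) refl h′

  ≤2h′⇒<g : ∀ {ℓ} → ℓ ≤ suc (h′ + h′) → ℓ < g
  ≤2h′⇒<g {ℓ} ℓ≤ = subst (ℓ <_) (sym g≡) (s≤s ℓ≤)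

  ≤h⇒2+≤g : ∀ {ℓ} → ℓ ≤ suc h′ → 2 + ℓ ≤ g
  ≤h⇒2+≤g {ℓ} ℓ≤h = subst (2 + ℓ ≤_) (sym g≡) (s≤s (s≤s (ℕ.≤-trans ℓ≤h (ℕ.+-monoˡ-≤ h′ 1≤h′))))

  nbWalks-unique : ∀ {p c r r′} → Adj p c → NBWalk p c r → NBWalk p c r′ → walkEnd c r ≡ walkEnd c r′ →
                   length r ≤ suc h′ → length r′ ≤ suc h′ → length r + length r′ < g → r ≡ r′
  nbWalks-unique {p} {c} {r} {r′} p~c walk walk′ sameEnd ∣r∣≤h ∣r′∣≤h =
    paths-unique c r r′ (nbWalk⇒path p c r p~c walk (≤h⇒2+≤g ∣r∣≤h)) (nbWalk⇒path p c r′ p~c walk′ (≤h⇒2+≤g ∣r′∣≤h)) sameEnd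

  opposite-nbWalks-apart : ∀ {u v r r′} → Adj u v → NBWalk v u r → NBWalk u v r′ →
                           length r ≤ suc h′ → length r′ ≤ h′ → length r + suc (length r′) < g → ¬ walkEnd u r ≡ walkEnd v r′
  opposite-nbWalks-apart {u} {v} {r} {r′} u~v walk walk′ ∣r∣≤h ∣r′∣≤h′ ∣r∣+∣v∷r′∣<g sameEnd
    with refl ← paths-unique u r (v ∷ r′) (nbWalk⇒path v u r (Adj-sym u~v) walk (≤h⇒2+≤g ∣r∣≤h))
                  (nbWalk⇒unique u v r′ u~v walk′ (≤h⇒2+≤g (ℕ.m≤n⇒m≤1+n ∣r′∣≤h′)) , u~v ∷ NBWalk⇒Linked u v r′ walk′)
                  sameEnd ∣r∣+∣v∷r′∣<g
    with (_ , v≢v) , _ ← walk = v≢v refl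

  walksTo≤1 : ∀ {p c} m z → Adj p c → m ≤ h′ → walksTo p c m z ≤ 1
  walksTo≤1 {p} {c} m z p~c m≤h′ = subst (_≤ 1) (sym (walksTo≡∑⟦end⟧ p c m z))
    (sumWords≤1 m (λ r → ⟦ endsAt? r ⟧) (λ r → ⟦⟧≤1 (endsAt? r)) atMostOne)
    where
    endsAt? : ∀ r → Dec (NBWalk p c r × walkEnd c r ≡ z)
    endsAt? r = nbWalk? p c r ×-dec walkEnd c r Fin.≟ z
    ≤h′ : ∀ r → length r ≡ m → length r ≤ h′
    ≤h′ r ∣r∣≡m = subst (_≤ h′) (sym ∣r∣≡m) m≤h′
    atMostOne : ∀ r r′ → length r ≡ m → length r′ ≡ m → ¬ ⟦ endsAt? r ⟧ ≡ 0 → ¬ ⟦ endsAt? r′ ⟧ ≡ 0 → r ≡ r′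
    atMostOne r r′ ∣r∣≡m ∣r′∣≡m ⟦r⟧≢0 ⟦r′⟧≢0
      with walk , end≡z ← ⟦⟧≢0⇒ (endsAt? r) ⟦r⟧≢0 | walk′ , end′≡z ← ⟦⟧≢0⇒ (endsAt? r′) ⟦r′⟧≢0 =
      nbWalks-unique p~c walk walk′ (trans end≡z (sym end′≡z)) (ℕ.m≤n⇒m≤1+n (≤h′ r ∣r∣≡m)) (ℕ.m≤n⇒m≤1+n (≤h′ r′ ∣r′∣≡m))
                     (≤2h′⇒<g (ℕ.m≤n⇒m≤1+n (ℕ.+-mono-≤ (≤h′ r ∣r∣≡m) (≤h′ r′ ∣r′∣≡m))))

  cycle⇒nbWalk : ∀ u a r → IsCycleList G (u ∷ a ∷ r) → NBWalk u a r
  cycle⇒nbWalk u a r (cycle! , cycle~) = path⇒NBWalk u a r cycle! (Linked-++⁻ˡ (a ∷ r) (Linked.tail cycle~))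

  -- With z the last vertex of r₁, the arc z ∷ r₂ ∷ u ∷ a of the cycle read backwards is the walk
  cycle⇒returnWalk : ∀ u a r₁ r₂ → length r₁ ≡ h′ → Adj u a → IsCycleList G (u ∷ a ∷ r₁ ++ r₂) →
                     NBWalk a u (reverse r₂ ∷ʳ walkEnd a r₁)
  cycle⇒returnWalk u a r₁ r₂ ∣r₁∣≡h′ u~a cyc with initLast r₁
  cycle⇒returnWalk u a _ r₂ ∣r₁∣≡h′ u~a cyc | [] with () ← subst (1 ≤_) (sym ∣r₁∣≡h′) 1≤h′
  cycle⇒returnWalk u a _ r₂ ∣r₁∣≡h′ u~a (cycle! , cycle~) | ri ∷ʳ′ z =
    subst (λ e → NBWalk a u (reverse r₂ ∷ʳ e)) (sym (walkEnd-∷ʳ a ri z))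
      (path⇒NBWalk a u (reverse r₂ ∷ʳ z) (subst Unique reverse-T (Unique-reverse T T!))
                                           (Linked.tail (subst (Linked Adj) reverse-T (Linked-reverse Adj-sym T T~))))
    where
    regroup : u ∷ a ∷ (ri ∷ʳ z) ++ r₂ ≡ (u ∷ a ∷ ri) ++ z ∷ r₂
    regroup = cong (λ t → u ∷ a ∷ t) (++-assoc ri [ z ] r₂)
    split! : Unique ((u ∷ a ∷ ri) ++ z ∷ r₂)
    split! = subst Unique regroup cycle!
    split~ : Linked Adj ((u ∷ a ∷ ri) ++ z ∷ r₂ ∷ʳ u)
    split~ = subst (Linked Adj) (trans (cong (_∷ʳ u) regroup) (++-assoc (u ∷ a ∷ ri) (z ∷ r₂) [ u ])) cycle~
    T : List V
    T = (z ∷ r₂) ++ u ∷ a ∷ []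
    T~ : Linked Adj T
    T~ = Linked-join (z ∷ r₂) (Linked-++⁻ʳ (u ∷ a ∷ ri) split~) (u~a ∷ [-])
    T! : Unique T
    T! = Unique.++⁺ (Unique-++⁻ʳ (u ∷ a ∷ ri) split!) (Unique-∷ (λ { (here refl) → irrefl u~a }) (Unique-∷ (λ ()) AllPairs.[]))
           λ { (w∈ , here refl)         → Unique-++⇒disjoint (u ∷ a ∷ ri) split! (here refl) w∈
             ; (w∈ , there (here refl)) → Unique-++⇒disjoint (u ∷ a ∷ ri) split! (there (here refl)) w∈ }
    reverse-T : reverse T ≡ a ∷ u ∷ reverse r₂ ∷ʳ z
    reverse-T = trans (reverse-++ (z ∷ r₂) (u ∷ a ∷ [])) (cong (λ t → a ∷ u ∷ t) (unfold-reverse z r₂))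

  private
    ∷ʳ-view : (xs : List V) (x : V) → ∃₂ λ b s → xs ∷ʳ x ≡ b ∷ s
    ∷ʳ-view []       x = x , [] , refl
    ∷ʳ-view (y ∷ xs) x = y , xs ∷ʳ x , refl

  -- The two walks from u have total length 2 (h′ + 1), so they meet only at their common end
  returnWalk⇒cycle : ∀ u a r₁ r₂ → length r₁ ≡ h′ → length r₂ ≡ h′ → Adj u a → NBWalk u a r₁ →
                     NBWalk a u (reverse r₂ ∷ʳ walkEnd a r₁) → IsCycleList G (u ∷ a ∷ r₁ ++ r₂)
  returnWalk⇒cycle u a r₁ r₂ ∣r₁∣≡h′ ∣r₂∣≡h′ u~a out back
    with b , s , back≡ ← ∷ʳ-view (reverse r₂) (walkEnd a r₁)
    with back′@((_ , b≢a) , _) ← subst (NBWalk a u) back≡ back =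
    subst (IsCycleList G) (sym regroup) isCycle
    where
    ∣b∷s∣≡h : length (b ∷ s) ≡ suc h′
    ∣b∷s∣≡h = trans (cong length (sym back≡)) (trans (length-++ (reverse r₂))
                (trans (cong (_+ 1) (trans (length-reverse r₂) ∣r₂∣≡h′)) (ℕ.+-comm h′ 1)))
    path₁ : IsPath (u ∷ a ∷ r₁)
    path₁ = nbWalk⇒unique u a r₁ u~a out (≤h⇒2+≤g (subst (_≤ suc h′) (sym ∣r₁∣≡h′) (ℕ.n≤1+n h′))) ,
            u~a ∷ NBWalk⇒Linked u a r₁ out
    path₂ : IsPath (u ∷ b ∷ s)
    path₂ = nbWalk⇒path a u (b ∷ s) (Adj-sym u~a) back′ (≤h⇒2+≤g (ℕ.≤-reflexive ∣b∷s∣≡h))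
    sameEnd : walkEnd a r₁ ≡ walkEnd b s
    sameEnd = sym (trans (cong (walkEnd u) (sym back≡)) (walkEnd-∷ʳ u (reverse r₂) (walkEnd a r₁)))
    ∣w₁∣+∣w₂∣≤g : length (a ∷ r₁) + length (b ∷ s) ≤ g
    ∣w₁∣+∣w₂∣≤g = ℕ.≤-reflexive (trans (cong₂ _+_ (cong suc ∣r₁∣≡h′) ∣b∷s∣≡h)
                                 (solve 1 (λ h → (con 1 :+ h) :+ (con 1 :+ h) := con 2 :* (con 1 :+ h)) refl h′))
    tight : Σ (Fork u (a ∷ r₁) (b ∷ s)) λ F → Fork.bs F ≡ [] × Fork.ds F ≡ []
    tight = fork-≤g u a r₁ b s (λ a≡b → b≢a (sym a≡b)) path₁ path₂ sameEnd ∣w₁∣+∣w₂∣≤g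
    open Fork (proj₁ tight)
    r₂≡ : r₂ ≡ reverse cs
    r₂≡ = trans (sym (reverse-involutive r₂)) (cong reverse (∷ʳ-injectiveˡ (reverse r₂) cs
            (trans back≡ (subst (λ t → b ∷ s ≡ cs ++ x ∷ t) (proj₂ (proj₂ tight)) split₂))))
    regroup : u ∷ a ∷ r₁ ++ r₂ ≡ cycle
    regroup = cong (u ∷_) (trans (cong (_++ r₂) (subst (λ t → a ∷ r₁ ≡ as ++ x ∷ t) (proj₁ (proj₂ tight)) split₁))
                                 (trans (++-assoc as [ x ] r₂) (cong (λ t → as ++ x ∷ t) r₂≡)))

  cyclesExtending : ∀ u a → Adj u a → ∀ r₁ → length r₁ ≡ h′ →
    sumWords h′ (λ r₂ → ⟦ isCycleList? G (u ∷ a ∷ r₁ ++ r₂) ⟧) ≡ ⟦ nbWalk? u a r₁ ⟧ * walksTo a u (suc h′) (walkEnd a r₁)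
  cyclesExtending u a u~a r₁ ∣r₁∣≡h′ with nbWalk? u a r₁
  ... | no ¬out = sumWords-zero h′ (λ r₂ _ → ⟦⟧-≡0 (isCycleList? G _)
                    (λ cyc → ¬out (NBWalk-++⁻ˡ u a r₁ r₂ (cycle⇒nbWalk u a (r₁ ++ r₂) cyc))))
  ... | yes out = begin
    sumWords h′ (λ r₂ → ⟦ isCycleList? G (u ∷ a ∷ r₁ ++ r₂) ⟧)
      ≡⟨ sumWords-cong h′ (λ r₂ ∣r₂∣≡h′ → ⟦⟧-⇔ (cycle⇒returnWalk u a r₁ r₂ ∣r₁∣≡h′ u~a)
                                                (returnWalk⇒cycle u a r₁ r₂ ∣r₁∣≡h′ ∣r₂∣≡h′ u~a out) _ _) ⟩
    sumWords h′ (λ r₂ → ⟦ nbWalk? a u (reverse r₂ ∷ʳ walkEnd a r₁) ⟧)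
      ≡⟨ sumWords-reverse h′ (λ r → ⟦ nbWalk? a u (r ∷ʳ walkEnd a r₁) ⟧) ⟩
    sumWords h′ (λ r → ⟦ nbWalk? a u (r ∷ʳ walkEnd a r₁) ⟧)
      ≡⟨ walksTo-∷ʳ a u h′ (walkEnd a r₁) ⟨
    walksTo a u (suc h′) (walkEnd a r₁)
      ≡⟨ ℕ.+-identityʳ _ ⟨
    1 * walksTo a u (suc h′) (walkEnd a r₁)
      ∎
    where open ≡-Reasoning

  cyclesThroughEdge≡ : ∀ u a → Adj u a →
    cyclesThroughEdge G g u a ≡ ∑[ z < n ] (walksTo u a h′ z * walksTo a u (suc h′) z)
  cyclesThroughEdge≡ u a u~a = begin
    cyclesThroughEdge G g u a
      ≡⟨ length-filter-map-allLists G (isCycleList? G) (λ r → u ∷ a ∷ r) (g ∸ 2) ⟩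
    sumWords (g ∸ 2) (λ r → ⟦ isCycleList? G (u ∷ a ∷ r) ⟧)
      ≡⟨ cong (λ m → sumWords m (λ r → ⟦ isCycleList? G (u ∷ a ∷ r) ⟧)) (cong (_∸ 2) g≡) ⟩
    sumWords (h′ + h′) (λ r → ⟦ isCycleList? G (u ∷ a ∷ r) ⟧)
      ≡⟨ sumWords-++ h′ h′ _ ⟩
    sumWords h′ (λ r₁ → sumWords h′ (λ r₂ → ⟦ isCycleList? G (u ∷ a ∷ r₁ ++ r₂) ⟧))
      ≡⟨ sumWords-cong h′ (cyclesExtending u a u~a) ⟩
    walkSum u a h′ (walksTo a u (suc h′))
      ≡⟨ walkSum≡∑walksTo u a h′ _ ⟩
    ∑[ z < n ] (walksTo u a h′ z * walksTo a u (suc h′) z)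
      ∎
    where open ≡-Reasoning

  walksTo-same-length : ∀ {p c z} i j → Adj p c → i ≤ suc h′ → j ≤ suc h′ → i + j < g →
                        ¬ walksTo p c i z ≡ 0 → ¬ walksTo p c j z ≡ 0 → i ≡ j
  walksTo-same-length {p} {c} {z} i j p~c i≤h j≤h i+j<g ≢0ᵢ ≢0ⱼ
    with r , refl , walk , end≡z ← walksTo≢0⇒ p c i z ≢0ᵢ
    with r′ , refl , walk′ , end′≡z ← walksTo≢0⇒ p c j z ≢0ⱼ
    = cong length (nbWalks-unique p~c walk walk′ (trans end≡z (sym end′≡z)) i≤h j≤h i+j<g)

  walksTo-opposite-apart : ∀ {u v z} i j → Adj u v → i ≤ suc h′ → j ≤ h′ → i + suc j < g →
                           ¬ walksTo v u i z ≡ 0 → ¬ walksTo u v j z ≡ 0 → ⊥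
  walksTo-opposite-apart {u} {v} {z} i j u~v i≤h j≤h′ i+j<g ≢0ᵢ ≢0ⱼ
    with r , refl , walk , end≡z ← walksTo≢0⇒ v u i z ≢0ᵢ
    with r′ , refl , walk′ , end′≡z ← walksTo≢0⇒ u v j z ≢0ⱼ
    = opposite-nbWalks-apart u~v walk walk′ i≤h j≤h′ i+j<g (trans end≡z (sym end′≡z))

-- Counting around one edge

-- For an edge uv, let d z count the non-backtracking walks of length h′ + 1 from u (not via v) to z,
-- and e z ∈ {0, 1} those of length h′ from v (not via u).  The fields stand for
-- outWalks = Σ d (1 − e), inSquares = Σ (d e)², outSquares = Σ (d (1 − e))², inPairs = Σ C(d e, 2)
-- and outEnds = #{z | d z ≠ 0, e z = 0}.
record EdgeCounts (k h′ λ′ n : ℕ) : Set where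
  field
    outWalks outEnds inSquares outSquares inPairs : ℕ
    outWalks+λ≡       : outWalks + λ′ ≡ (k ∸ 1) ^ suc h′
    squares+λ≡        : inSquares + outSquares + λ′ ≡ (k ∸ 1) * (λ′ + (k ∸ 1) ^ h′)
    λ²≤               : λ′ * λ′ ≤ (k ∸ 1) ^ h′ * inSquares
    inSquares≡        : inSquares ≡ λ′ + 2 * inPairs
    outWalks²≤        : outWalks * outWalks ≤ outEnds * outSquares
    outWalks≤         : outWalks ≤ outSquares
    twoBalls+outEnds≤ : 2 * ∑[ j < suc h′ ] ((k ∸ 1) ^ toℕ j) + outEnds ≤ n

module EdgeCounting {n : ℕ} (G : Graph n) {k : ℕ} (regular : Regular G k) (h′ : ℕ) (1≤h′ : 1 ≤ h′)
                    (noShortCycle : ∀ ℓ → ℓ < 2 * suc h′ → ¬ HasCycleOfLength G ℓ) {λ′ : ℕ}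
                    (edgeRegular : ∀ u v → Graph.Adj G u v → cyclesThroughEdge G (2 * suc h′) u v ≡ λ′) where

  open Graph G renaming (sym to Adj-sym)
  open Walks G
  open Counting G
  open EvenGirth G h′ 1≤h′ noShortCycle

  ∑walksTo≡ : ∀ {p c} m → Adj p c → ∑[ z < n ] walksTo p c m z ≡ (k ∸ 1) ^ m
  ∑walksTo≡ {p} {c} m p~c = trans (∑walksTo≡#walks p c m) (#walks≡ regular m (Adj-sym p~c))

  ∑walksTo*walksTo≡λ : ∀ {u a} → Adj u a → ∑[ z < n ] (walksTo u a h′ z * walksTo a u (suc h′) z) ≡ λ′
  ∑walksTo*walksTo≡λ {u} {a} u~a = trans (sym (cyclesThroughEdge≡ u a u~a)) (edgeRegular u a u~a)

  freeWalksTo : V → V → ℕ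
  freeWalksTo u z = ∑[ b < n ] (⟦ adj? u b ⟧ * walksTo u b h′ z)

  freeWalksTo≡ : ∀ {u a} → Adj u a → ∀ z → freeWalksTo u z ≡ walksTo a u (suc h′) z + walksTo u a h′ z
  freeWalksTo≡ {u} {a} u~a z = begin
    ∑[ b < n ] (⟦ adj? u b ⟧ * walksTo u b h′ z)
      ≡⟨ sum-cong-≗ {n} (λ b → trans (cong (_* walksTo u b h′ z) (⟦adj⟧≡⟦forward⟧+δ u~a b)) (ℕ.*-distribʳ-+ _ ⟦ forward? a u b ⟧ (δ b a))) ⟩
    ∑[ b < n ] (⟦ forward? a u b ⟧ * walksTo u b h′ z + δ b a * walksTo u b h′ z)
      ≡⟨ ∑-distrib-+ (λ b → ⟦ forward? a u b ⟧ * walksTo u b h′ z) _ ⟩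
    ∑[ b < n ] (⟦ forward? a u b ⟧ * walksTo u b h′ z) + ∑[ b < n ] (δ b a * walksTo u b h′ z)
      ≡⟨ cong₂ _+_ (sym (walkSum-suc a u h′ (λ x → δ x z)))
                   (trans (sum-cong-≗ {n} (λ b → cong (_* walksTo u b h′ z) (δ-sym b a))) (sum-δ a (λ b → walksTo u b h′ z))) ⟩
    walksTo a u (suc h′) z + walksTo u a h′ z
      ∎
    where open ≡-Reasoning

  ∑walksTo*freeWalksTo≡ : ∀ {u a} → Adj u a → ∑[ z < n ] (walksTo u a h′ z * freeWalksTo u z) ≡ λ′ + (k ∸ 1) ^ h′
  ∑walksTo*freeWalksTo≡ {u} {a} u~a = begin
    ∑[ z < n ] (walksTo u a h′ z * freeWalksTo u z)
      ≡⟨ sum-cong-≗ {n} (λ z → trans (cong (walksTo u a h′ z *_) (freeWalksTo≡ u~a z)) (ℕ.*-distribˡ-+ (walksTo u a h′ z) _ _)) ⟩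
    ∑[ z < n ] (walksTo u a h′ z * walksTo a u (suc h′) z + walksTo u a h′ z * walksTo u a h′ z)
      ≡⟨ ∑-distrib-+ (λ z → walksTo u a h′ z * walksTo a u (suc h′) z) _ ⟩
    ∑[ z < n ] (walksTo u a h′ z * walksTo a u (suc h′) z) + ∑[ z < n ] (walksTo u a h′ z * walksTo u a h′ z)
      ≡⟨ cong₂ _+_ (∑walksTo*walksTo≡λ u~a)
                   (trans (sum-cong-≗ {n} (λ z → b≤1⇒b*b≡b (walksTo≤1 h′ z u~a ℕ.≤-refl))) (∑walksTo≡ h′ u~a)) ⟩
    λ′ + (k ∸ 1) ^ h′
      ∎
    where open ≡-Reasoning

  module Edge {u v : V} (u~v : Adj u v) where

    d e : V → ℕ
    d = walksTo v u (suc h′)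
    e = walksTo u v h′

    e≤1 : ∀ z → e z ≤ 1
    e≤1 z = walksTo≤1 h′ z u~v ℕ.≤-refl

    ∑d*d+λ≡ : ∑[ z < n ] (d z * d z) + λ′ ≡ (k ∸ 1) * (λ′ + (k ∸ 1) ^ h′)
    ∑d*d+λ≡ = begin
      ∑[ z < n ] (d z * d z) + λ′
        ≡⟨ cong (∑[ z < n ] (d z * d z) +_) (trans (sym (∑walksTo*walksTo≡λ u~v)) (sum-cong-≗ {n} (λ z → ℕ.*-comm (e z) (d z)))) ⟩
      ∑[ z < n ] (d z * d z) + ∑[ z < n ] (d z * e z)
        ≡⟨ ∑-distrib-+ (λ z → d z * d z) _ ⟨
      ∑[ z < n ] (d z * d z + d z * e z)
        ≡⟨ sum-cong-≗ {n} (λ z → trans (sym (ℕ.*-distribˡ-+ (d z) (d z) (e z))) (cong (d z *_) (sym (freeWalksTo≡ u~v z)))) ⟩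
      ∑[ z < n ] (d z * freeWalksTo u z)
        ≡⟨ sum-cong-≗ {n} (λ z → trans (cong (_* freeWalksTo u z) (walkSum-suc v u h′ (λ x → δ x z)))
                                        (trans (*-distribʳ-sum (freeWalksTo u z) (λ a → ⟦ forward? v u a ⟧ * walksTo u a h′ z))
                                               (sum-cong-≗ {n} (λ a → ℕ.*-assoc ⟦ forward? v u a ⟧ (walksTo u a h′ z) (freeWalksTo u z))))) ⟩
      ∑[ z < n ] ∑[ a < n ] (⟦ forward? v u a ⟧ * (walksTo u a h′ z * freeWalksTo u z))
        ≡⟨ ∑-comm (λ z a → ⟦ forward? v u a ⟧ * (walksTo u a h′ z * freeWalksTo u z)) ⟩
      ∑[ a < n ] ∑[ z < n ] (⟦ forward? v u a ⟧ * (walksTo u a h′ z * freeWalksTo u z))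
        ≡⟨ sum-cong-≗ {n} (λ a → *-distribˡ-sum ⟦ forward? v u a ⟧ (λ z → walksTo u a h′ z * freeWalksTo u z)) ⟨
      ∑[ a < n ] (⟦ forward? v u a ⟧ * ∑[ z < n ] (walksTo u a h′ z * freeWalksTo u z))
        ≡⟨ sum-cong-≗ {n} (λ a → forward-*-cong _ _ (λ (u~a , _) → ∑walksTo*freeWalksTo≡ u~a)) ⟩
      ∑[ a < n ] (⟦ forward? v u a ⟧ * (λ′ + (k ∸ 1) ^ h′))
        ≡⟨ *-distribʳ-sum (λ′ + (k ∸ 1) ^ h′) (λ a → ⟦ forward? v u a ⟧) ⟨
      ∑[ a < n ] ⟦ forward? v u a ⟧ * (λ′ + (k ∸ 1) ^ h′)
        ≡⟨ cong (_* (λ′ + (k ∸ 1) ^ h′)) (∑⟦forward⟧≡k∸1 regular u~v) ⟩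
      (k ∸ 1) * (λ′ + (k ∸ 1) ^ h′)
        ∎
      where open ≡-Reasoning

    -- The indicator of the vertices reached from u (not via v) or from v (not via u) in at most h′ steps
    ball : V → ℕ
    ball z = ∑[ j < suc h′ ] (walksTo v u (toℕ j) z + walksTo u v (toℕ j) z)

    outEnd? : ∀ z → Dec (¬ d z ≡ 0 × e z ≡ 0)
    outEnd? z = ¬? (d z ℕ.≟ 0) ×-dec (e z ℕ.≟ 0)

    private
      i+1+j≤1+2h′ : ∀ {i j} → i ≤ h′ → j ≤ h′ → i + suc j ≤ suc (h′ + h′)
      i+1+j≤1+2h′ {i} {j} i≤h′ j≤h′ = subst (_≤ suc (h′ + h′)) (sym (ℕ.+-suc i j)) (s≤s (ℕ.+-mono-≤ i≤h′ j≤h′))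

      j≤h′ : (j : Fin (suc h′)) → toℕ j ≤ h′
      j≤h′ = toℕ≤pred[n]

      j≤h : (j : Fin (suc h′)) → toℕ j ≤ suc h′
      j≤h j = ℕ.m≤n⇒m≤1+n (j≤h′ j)

      sameSide : ∀ {p c z} → Adj p c → ∀ i j → ¬ walksTo p c (toℕ i) z ≡ 0 → ¬ walksTo p c (toℕ j) z ≡ 0 → i ≡ j
      sameSide p~c i j ≢0ᵢ ≢0ⱼ = toℕ-injective (walksTo-same-length (toℕ i) (toℕ j) p~c (j≤h i) (j≤h j)
        (≤2h′⇒<g (ℕ.m≤n⇒m≤1+n (ℕ.+-mono-≤ (j≤h′ i) (j≤h′ j)))) ≢0ᵢ ≢0ⱼ)

      otherSide : ∀ {z} i j → ¬ walksTo v u (toℕ i) z ≡ 0 → ¬ walksTo u v (toℕ j) z ≡ 0 → ⊥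
      otherSide i j = walksTo-opposite-apart (toℕ i) (toℕ j) u~v (j≤h i) (j≤h′ j) (≤2h′⇒<g (i+1+j≤1+2h′ (j≤h′ i) (j≤h′ j)))

    ball≤1 : ∀ z → ball z ≤ 1
    ball≤1 z = sum≤1 _ (λ j → m+n≤1 (walksTo≤1 (toℕ j) z (Adj-sym u~v) (j≤h′ j)) (walksTo≤1 (toℕ j) z u~v (j≤h′ j)) (otherSide j j))
                       sameIndex
      where
      sameIndex : ∀ i j → ¬ walksTo v u (toℕ i) z + walksTo u v (toℕ i) z ≡ 0 →
                          ¬ walksTo v u (toℕ j) z + walksTo u v (toℕ j) z ≡ 0 → i ≡ j
      sameIndex i j ≢0ᵢ ≢0ⱼ with m+n≢0⇒ (walksTo v u (toℕ i) z) ≢0ᵢ | m+n≢0⇒ (walksTo v u (toℕ j) z) ≢0ⱼ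
      ... | inj₁ uᵢ | inj₁ uⱼ = sameSide (Adj-sym u~v) i j uᵢ uⱼ
      ... | inj₁ uᵢ | inj₂ vⱼ = ⊥-elim (otherSide i j uᵢ vⱼ)
      ... | inj₂ vᵢ | inj₁ uⱼ = ⊥-elim (otherSide j i uⱼ vᵢ)
      ... | inj₂ vᵢ | inj₂ vⱼ = sameSide u~v i j vᵢ vⱼ

    outEnd⇒ball≡0 : ∀ z → ¬ ⟦ outEnd? z ⟧ ≡ 0 → ball z ≡ 0
    outEnd⇒ball≡0 z ⟦⟧≢0 with d≢0 , e≡0 ← ⟦⟧≢0⇒ (outEnd? z) ⟦⟧≢0 = sum-zero (λ j → cong₂ _+_ (fromU j) (fromV j))
      where
      fromU : ∀ j → walksTo v u (toℕ j) z ≡ 0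
      fromU j with walksTo v u (toℕ j) z ℕ.≟ 0
      ... | yes ≡0 = ≡0
      ... | no ≢0 = ⊥-elim (ℕ.<-irrefl refl (subst (_≤ h′) j≡h (j≤h′ j)))
        where
        j≡h : toℕ j ≡ suc h′
        j≡h = walksTo-same-length (toℕ j) (suc h′) (Adj-sym u~v) (j≤h j) ℕ.≤-refl
                (≤2h′⇒<g (subst (_≤ suc (h′ + h′)) (ℕ.+-comm (suc h′) (toℕ j)) (s≤s (ℕ.+-monoʳ-≤ h′ (j≤h′ j))))) ≢0 d≢0
      fromV : ∀ j → walksTo u v (toℕ j) z ≡ 0
      fromV j with walksTo u v (toℕ j) z ℕ.≟ 0 | ℕ.m≤n⇒m<n∨m≡n (j≤h′ j)
      ... | yes ≡0 | _ = ≡0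
      ... | no ≢0 | inj₂ j≡h′ = ⊥-elim (≢0 (trans (cong (λ m → walksTo u v m z) j≡h′) e≡0))
      ... | no ≢0 | inj₁ j<h′ = ⊥-elim (walksTo-opposite-apart (suc h′) (toℕ j) u~v ℕ.≤-refl (j≤h′ j)
                                  (≤2h′⇒<g (s≤s (ℕ.+-monoʳ-≤ h′ j<h′))) d≢0 ≢0)

    ∑ball≡ : ∑[ z < n ] ball z ≡ 2 * ∑[ j < suc h′ ] ((k ∸ 1) ^ toℕ j)
    ∑ball≡ = begin
      ∑[ z < n ] ∑[ j < suc h′ ] (walksTo v u (toℕ j) z + walksTo u v (toℕ j) z)
        ≡⟨ ∑-comm {n} {suc h′} (λ z j → walksTo v u (toℕ j) z + walksTo u v (toℕ j) z) ⟩
      ∑[ j < suc h′ ] ∑[ z < n ] (walksTo v u (toℕ j) z + walksTo u v (toℕ j) z)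
        ≡⟨ sum-cong-≗ {suc h′} (λ j → trans (∑-distrib-+ (walksTo v u (toℕ j)) (walksTo u v (toℕ j)))
                                             (cong₂ _+_ (∑walksTo≡ (toℕ j) (Adj-sym u~v)) (∑walksTo≡ (toℕ j) u~v))) ⟩
      ∑[ j < suc h′ ] ((k ∸ 1) ^ toℕ j + (k ∸ 1) ^ toℕ j)
        ≡⟨ ∑-distrib-+ {suc h′} (λ j → (k ∸ 1) ^ toℕ j) (λ j → (k ∸ 1) ^ toℕ j) ⟩
      treeSize + treeSize
        ≡⟨ cong (treeSize +_) (ℕ.+-identityʳ treeSize) ⟨
      2 * treeSize
        ∎
      where
      open ≡-Reasoning
      treeSize : ℕ
      treeSize = ∑[ j < suc h′ ] ((k ∸ 1) ^ toℕ j)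

    twoBalls+outEnds≤n : 2 * ∑[ j < suc h′ ] ((k ∸ 1) ^ toℕ j) + ∑[ z < n ] ⟦ outEnd? z ⟧ ≤ n
    twoBalls+outEnds≤n = subst₂ _≤_ (trans (∑-distrib-+ ball (λ z → ⟦ outEnd? z ⟧)) (cong (_+ ∑[ z < n ] ⟦ outEnd? z ⟧) ∑ball≡)) (sum-ones n)
      (sum-mono-≤ λ z → m+n≤1 (ball≤1 z) (⟦⟧≤1 (outEnd? z)) (λ ball≢0 ⟦⟧≢0 → ball≢0 (outEnd⇒ball≡0 z ⟦⟧≢0)))

    din dout : V → ℕ
    din  z = d z * e z
    dout z = d z * (1 ∸ e z)

    ∑din≡λ : ∑[ z < n ] din z ≡ λ′
    ∑din≡λ = trans (sum-cong-≗ {n} (λ z → ℕ.*-comm (d z) (e z))) (∑walksTo*walksTo≡λ u~v)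

    ∑dout+λ≡ : ∑[ z < n ] dout z + λ′ ≡ (k ∸ 1) ^ suc h′
    ∑dout+λ≡ = begin
      ∑[ z < n ] dout z + λ′                    ≡⟨ cong (∑[ z < n ] dout z +_) ∑din≡λ ⟨
      ∑[ z < n ] dout z + ∑[ z < n ] din z      ≡⟨ ℕ.+-comm (∑[ z < n ] dout z) _ ⟩
      ∑[ z < n ] din z + ∑[ z < n ] dout z      ≡⟨ ∑-distrib-+ din dout ⟨
      ∑[ z < n ] (din z + dout z)               ≡⟨ sum-cong-≗ {n} (λ z → m≡m*b+m*[1∸b] {m = d z} (e≤1 z)) ⟨
      ∑[ z < n ] d z                            ≡⟨ ∑walksTo≡ (suc h′) (Adj-sym u~v) ⟩
      (k ∸ 1) ^ suc h′                          ∎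
      where open ≡-Reasoning

    ∑din²+∑dout²+λ≡ : ∑[ z < n ] (din z * din z) + ∑[ z < n ] (dout z * dout z) + λ′ ≡ (k ∸ 1) * (λ′ + (k ∸ 1) ^ h′)
    ∑din²+∑dout²+λ≡ = trans (cong (_+ λ′) (trans (sym (∑-distrib-+ (λ z → din z * din z) _))
                                                 (sym (sum-cong-≗ {n} (λ z → m*m≡[m*b]²+[m*[1∸b]]² {m = d z} (e≤1 z))))))
                            ∑d*d+λ≡

    λ*λ≤ : λ′ * λ′ ≤ (k ∸ 1) ^ h′ * ∑[ z < n ] (din z * din z)
    λ*λ≤ = subst₂ (λ s t → s * s ≤ t * ∑[ z < n ] (din z * din z)) ∑din≡λ (∑walksTo≡ h′ u~v)
                  (cauchy-schwarz-01 e din e≤1 (λ z → b*[m*b]≡m*b {m = d z} (e≤1 z)))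

    ∑din²≡ : ∑[ z < n ] (din z * din z) ≡ λ′ + 2 * ∑[ z < n ] (din z C 2)
    ∑din²≡ = trans (sum-cong-≗ {n} (λ z → n*n≡n+2*nC2 (din z)))
                   (trans (∑-distrib-+ din _) (cong₂ _+_ ∑din≡λ (sym (*-distribˡ-sum 2 (λ z → din z C 2)))))

    ⟦outEnd⟧*dout≡dout : ∀ z → ⟦ outEnd? z ⟧ * dout z ≡ dout z
    ⟦outEnd⟧*dout≡dout z with dout z ℕ.≟ 0
    ... | yes dout≡0 = trans (cong (⟦ outEnd? z ⟧ *_) dout≡0) (trans (ℕ.*-zeroʳ ⟦ outEnd? z ⟧) (sym dout≡0))
    ... | no dout≢0  = trans (cong (_* dout z) (⟦⟧-≡1 (outEnd? z) (m*[1∸b]≢0⇒ {m = d z} (e≤1 z) dout≢0))) (ℕ.+-identityʳ _)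

    edgeCounts : EdgeCounts k h′ λ′ n
    edgeCounts = record
      { outWalks          = ∑[ z < n ] dout z
      ; outEnds           = ∑[ z < n ] ⟦ outEnd? z ⟧
      ; inSquares         = ∑[ z < n ] (din z * din z)
      ; outSquares        = ∑[ z < n ] (dout z * dout z)
      ; inPairs           = ∑[ z < n ] (din z C 2)
      ; outWalks+λ≡       = ∑dout+λ≡
      ; squares+λ≡        = ∑din²+∑dout²+λ≡
      ; λ²≤               = λ*λ≤
      ; inSquares≡        = ∑din²≡
      ; outWalks²≤        = cauchy-schwarz-01 (λ z → ⟦ outEnd? z ⟧) dout (λ z → ⟦⟧≤1 (outEnd? z)) ⟦outEnd⟧*dout≡dout
      ; outWalks≤         = sum-mono-≤ (λ z → m≤m*m (dout z))
      ; twoBalls+outEnds≤ = twoBalls+outEnds≤n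
      }

-- The bound in ℚ

open import Data.Integer using (+_)

↥ℤ→ℚ : ∀ i → ↥ (ℤ→ℚ i) ≡ i
↥ℤ→ℚ i = trans (sym (ℤ.*-identityʳ _)) (trans (cong (λ t → ↥ (ℤ→ℚ i) ℤ.* + t) (sym (gcd-zeroʳ ℤ.∣ i ∣))) (ℚ.↥-/ i 1))

↧ℤ→ℚ : ∀ i → ↧ (ℤ→ℚ i) ≡ + 1
↧ℤ→ℚ i = trans (sym (ℤ.*-identityʳ _)) (trans (cong (λ t → ↧ (ℤ→ℚ i) ℤ.* + t) (sym (gcd-zeroʳ ℤ.∣ i ∣))) (ℚ.↧-/ i 1))

private
  toℚᵘ-ℤ→ℚ : ∀ i → toℚᵘ (ℤ→ℚ i) ℚᵘ.≃ ℚᵘ.mkℚᵘ i 0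
  toℚᵘ-ℤ→ℚ i = ℚ.toℚᵘ-fromℚᵘ (ℚᵘ.mkℚᵘ i 0)

ℤ→ℚ-+ : ∀ i j → ℤ→ℚ (i ℤ.+ j) ≡ ℤ→ℚ i ℚ.+ ℤ→ℚ j
ℤ→ℚ-+ i j = ℚ.toℚᵘ-injective (ℚᵘ.≃-trans (toℚᵘ-ℤ→ℚ (i ℤ.+ j)) (ℚᵘ.≃-trans over1
  (ℚᵘ.≃-sym (ℚᵘ.≃-trans (ℚ.toℚᵘ-homo-+ (ℤ→ℚ i) (ℤ→ℚ j)) (ℚᵘ.+-cong (toℚᵘ-ℤ→ℚ i) (toℚᵘ-ℤ→ℚ j))))))
  where
  over1 : ℚᵘ.mkℚᵘ (i ℤ.+ j) 0 ℚᵘ.≃ ℚᵘ.mkℚᵘ i 0 ℚᵘ.+ ℚᵘ.mkℚᵘ j 0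
  over1 = ℚᵘ.*≡* (cong (ℤ._* + 1) (cong₂ ℤ._+_ (sym (ℤ.*-identityʳ i)) (sym (ℤ.*-identityʳ j))))

ℤ→ℚ-* : ∀ i j → ℤ→ℚ (i ℤ.* j) ≡ ℤ→ℚ i ℚ.* ℤ→ℚ j
ℤ→ℚ-* i j = ℚ.toℚᵘ-injective (ℚᵘ.≃-trans (toℚᵘ-ℤ→ℚ (i ℤ.* j))
  (ℚᵘ.≃-sym (ℚᵘ.≃-trans (ℚ.toℚᵘ-homo-* (ℤ→ℚ i) (ℤ→ℚ j)) (ℚᵘ.*-cong (toℚᵘ-ℤ→ℚ i) (toℚᵘ-ℤ→ℚ j)))))

ℤ→ℚ-neg : ∀ i → ℤ→ℚ (ℤ.- i) ≡ ℚ.- ℤ→ℚ i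
ℤ→ℚ-neg i = ℚ.toℚᵘ-injective (ℚᵘ.≃-trans (toℚᵘ-ℤ→ℚ (ℤ.- i))
  (ℚᵘ.≃-sym (ℚᵘ.≃-trans (ℚ.toℚᵘ-homo‿- (ℤ→ℚ i)) (ℚᵘ.-‿cong (toℚᵘ-ℤ→ℚ i)))))

ℤ→ℚ-mono-≤ : ∀ {i j} → i ℤ.≤ j → ℤ→ℚ i ℚ.≤ ℤ→ℚ j
ℤ→ℚ-mono-≤ {i} {j} i≤j = *≤* (subst₂ ℤ._≤_ (sym (cong₂ ℤ._*_ (↥ℤ→ℚ i) (↧ℤ→ℚ j))) (sym (cong₂ ℤ._*_ (↥ℤ→ℚ j) (↧ℤ→ℚ i)))
  (subst₂ ℤ._≤_ (sym (ℤ.*-identityʳ i)) (sym (ℤ.*-identityʳ j)) i≤j))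

ℤ→ℚ-mono-< : ∀ {i j} → i ℤ.< j → ℤ→ℚ i ℚ.< ℤ→ℚ j
ℤ→ℚ-mono-< {i} {j} i<j = *<* (subst₂ ℤ._<_ (sym (cong₂ ℤ._*_ (↥ℤ→ℚ i) (↧ℤ→ℚ j))) (sym (cong₂ ℤ._*_ (↥ℤ→ℚ j) (↧ℤ→ℚ i)))
  (subst₂ ℤ._<_ (sym (ℤ.*-identityʳ i)) (sym (ℤ.*-identityʳ j)) i<j))

private
  floor≡ : ∀ p → floor p ≡ ↥ p ℤ./ ↧ p
  floor≡ (mkℚ _ _ _) = refl

  ceiling≡ : ∀ p → ceiling p ≡ ℤ.- floor (ℚ.- p)
  ceiling≡ (mkℚ _ _ _) = refl

ceiling-≤ : ∀ p i → p ℚ.≤ ℤ→ℚ i → ceiling p ℤ.≤ i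
ceiling-≤ p i p≤i = subst (ℤ._≤ i) (sym (trans (ceiling≡ p) (cong ℤ.-_ ⌊-p⌋≡quot)))
                                      (subst (ℤ.- quot ℤ.≤_) (ℤ.neg-involutive i) (ℤ.neg-mono-≤ -i≤quot))
  where
  -p : ℚ
  -p = ℚ.- p
  quot : ℤ
  quot = ↥ -p ℤ./ℕ ↧ₙ -p
  ⌊-p⌋≡quot : floor -p ≡ quot
  ⌊-p⌋≡quot = trans (floor≡ -p) (div-pos-is-/ℕ (↥ -p) (↧ₙ -p))
  -i*d≤↥-p : (ℤ.- i) ℤ.* ↧ -p ℤ.≤ ↥ -p
  -i*d≤↥-p = subst₂ ℤ._≤_ (cong (ℤ._* ↧ -p) (↥ℤ→ℚ (ℤ.- i))) (trans (cong (↥ -p ℤ.*_) (↧ℤ→ℚ (ℤ.- i))) (ℤ.*-identityʳ (↥ -p)))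
               (ℚ.drop-*≤* (subst (ℚ._≤ -p) (sym (ℤ→ℚ-neg i)) (ℚ.neg-antimono-≤ p≤i)))
  -i≤quot : ℤ.- i ℤ.≤ quot
  -i≤quot with ℤ.- i ℤ.≤? quot
  ... | yes -i≤quot = -i≤quot
  ... | no -i≰quot = ⊥-elim (ℤ.<-irrefl refl (ℤ.≤-<-trans -i*d≤↥-p (ℤ.<-≤-trans (n<s[n/ℕd]*d (↥ -p) (↧ₙ -p))
                     (ℤ.*-monoʳ-≤-nonNeg (↧ -p) (ℤ.i<j⇒suc[i]≤j (ℤ.≰⇒> -i≰quot))))))

ℕ→ℚ-+ : ∀ m n → ℕ→ℚ (m ℕ.+ n) ≡ ℕ→ℚ m ℚ.+ ℕ→ℚ n
ℕ→ℚ-+ m n = trans (cong ℤ→ℚ (ℤ.pos-+ m n)) (ℤ→ℚ-+ (+ m) (+ n))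

ℕ→ℚ-* : ∀ m n → ℕ→ℚ (m ℕ.* n) ≡ ℕ→ℚ m ℚ.* ℕ→ℚ n
ℕ→ℚ-* m n = trans (cong ℤ→ℚ (ℤ.pos-* m n)) (ℤ→ℚ-* (+ m) (+ n))

ℕ→ℚ-mono-≤ : ∀ {m n} → m ℕ.≤ n → ℕ→ℚ m ℚ.≤ ℕ→ℚ n
ℕ→ℚ-mono-≤ m≤n = ℤ→ℚ-mono-≤ (ℤ.+≤+ m≤n)

ℕ→ℚ-suc-positive : ∀ m → ℚ.Positive (ℕ→ℚ (suc m))
ℕ→ℚ-suc-positive m = ℚ.positive (ℤ→ℚ-mono-< {+ 0} {+ suc m} (ℤ.+<+ (s≤s z≤n)))

ℕ→ℚ-suc≢0 : ∀ m → ¬ ℕ→ℚ (suc m) ≡ 0ℚ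
ℕ→ℚ-suc≢0 m eq with () ← trans (sym (↥ℤ→ℚ (+ suc m))) (cong ↥_ eq)

module _ {p q : ℚ} (q≢0 : ¬ q ≡ 0ℚ) where

  ÷₀≡÷ : p ÷₀ q ≡ ℚ._÷_ p q {{ℚ.≢-nonZero q≢0}}
  ÷₀≡÷ with q ℚ.≟ 0ℚ
  ... | yes q≡0 = ⊥-elim (q≢0 q≡0)
  ... | no _    = refl

  ÷₀-*-cancel : (p ÷₀ q) ℚ.* q ≡ p
  ÷₀-*-cancel = begin
    (p ÷₀ q) ℚ.* q                                ≡⟨ cong (ℚ._* q) ÷₀≡÷ ⟩
    p ℚ.* ℚ.1/_ q {{ℚ.≢-nonZero q≢0}} ℚ.* q       ≡⟨ ℚ.*-assoc p _ q ⟩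
    p ℚ.* (ℚ.1/_ q {{ℚ.≢-nonZero q≢0}} ℚ.* q)     ≡⟨ cong (p ℚ.*_) (ℚ.*-inverseˡ q {{ℚ.≢-nonZero q≢0}}) ⟩
    p ℚ.* ℚ.1ℚ                                    ≡⟨ ℚ.*-identityʳ p ⟩
    p                                             ∎
    where open ≡-Reasoning

*-÷₀-cancelˡ : ∀ {q} r → ¬ q ≡ 0ℚ → (q ℚ.* r) ÷₀ q ≡ r
*-÷₀-cancelˡ {q} r q≢0 = begin
  (q ℚ.* r) ÷₀ q                                 ≡⟨ ÷₀≡÷ q≢0 ⟩
  q ℚ.* r ℚ.* ℚ.1/_ q {{ℚ.≢-nonZero q≢0}}        ≡⟨ cong (ℚ._* _) (ℚ.*-comm q r) ⟩
  r ℚ.* q ℚ.* ℚ.1/_ q {{ℚ.≢-nonZero q≢0}}        ≡⟨ ℚ.*-assoc r q _ ⟩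
  r ℚ.* (q ℚ.* ℚ.1/_ q {{ℚ.≢-nonZero q≢0}})      ≡⟨ cong (r ℚ.*_) (ℚ.*-inverseʳ q {{ℚ.≢-nonZero q≢0}}) ⟩
  r ℚ.* ℚ.1ℚ                                     ≡⟨ ℚ.*-identityʳ r ⟩
  r                                              ∎
  where open ≡-Reasoning

0÷₀q≡0 : ∀ q → 0ℚ ÷₀ q ≡ 0ℚ
0÷₀q≡0 q with q ℚ.≟ 0ℚ
... | yes _   = refl
... | no q≢0 = ℚ.*-zeroˡ (ℚ.1/_ q {{ℚ.≢-nonZero q≢0}})

÷₀-≤ : ∀ {p c} m → p ℚ.≤ c ℚ.* ℕ→ℚ (suc m) → p ÷₀ ℕ→ℚ (suc m) ℚ.≤ c
÷₀-≤ {p} {c} m p≤c*q = ℚ.*-cancelʳ-≤-pos (ℕ→ℚ (suc m)) {{ℕ→ℚ-suc-positive m}}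
                         (subst (ℚ._≤ c ℚ.* ℕ→ℚ (suc m)) (sym (÷₀-*-cancel (ℕ→ℚ-suc≢0 m))) p≤c*q)

x+y-y≡x : ∀ x y → x ℚ.+ y ℚ.- y ≡ x
x+y-y≡x x y = trans (ℚ.+-assoc x y (ℚ.- y)) (trans (cong (x ℚ.+_) (ℚ.+-inverseʳ y)) (ℚ.+-identityʳ x))

[x-y]*z≡x*z-y*z : ∀ x y z → (x ℚ.- y) ℚ.* z ≡ x ℚ.* z ℚ.- y ℚ.* z
[x-y]*z≡x*z-y*z x y z = trans (ℚ.*-distribʳ-+ z x (ℚ.- y)) (cong (x ℚ.* z ℚ.+_) (sym (ℚ.neg-distribˡ-* y z)))

2*[N-1]÷₀[1+q]≡2*A : ∀ q {N A} → suc q ℕ.* A ℕ.+ 1 ≡ N → (ℕ→ℚ 2 ℚ.* (ℕ→ℚ N ℚ.- ℕ→ℚ 1)) ÷₀ ℕ→ℚ (suc q) ≡ ℕ→ℚ (2 ℕ.* A)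
2*[N-1]÷₀[1+q]≡2*A q {N} {A} [1+q]A+1≡N = begin
  (ℕ→ℚ 2 ℚ.* (ℕ→ℚ N ℚ.- ℕ→ℚ 1)) ÷₀ ℕ→ℚ (suc q)
    ≡⟨ cong (λ t → (ℕ→ℚ 2 ℚ.* (ℕ→ℚ t ℚ.- ℕ→ℚ 1)) ÷₀ ℕ→ℚ (suc q)) (sym [1+q]A+1≡N) ⟩
  (ℕ→ℚ 2 ℚ.* (ℕ→ℚ (suc q ℕ.* A ℕ.+ 1) ℚ.- ℕ→ℚ 1)) ÷₀ ℕ→ℚ (suc q)
    ≡⟨ cong (λ t → (ℕ→ℚ 2 ℚ.* (t ℚ.- ℕ→ℚ 1)) ÷₀ ℕ→ℚ (suc q)) (ℕ→ℚ-+ (suc q ℕ.* A) 1) ⟩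
  (ℕ→ℚ 2 ℚ.* (ℕ→ℚ (suc q ℕ.* A) ℚ.+ ℕ→ℚ 1 ℚ.- ℕ→ℚ 1)) ÷₀ ℕ→ℚ (suc q)
    ≡⟨ cong (λ t → (ℕ→ℚ 2 ℚ.* t) ÷₀ ℕ→ℚ (suc q)) (x+y-y≡x (ℕ→ℚ (suc q ℕ.* A)) (ℕ→ℚ 1)) ⟩
  (ℕ→ℚ 2 ℚ.* ℕ→ℚ (suc q ℕ.* A)) ÷₀ ℕ→ℚ (suc q)
    ≡⟨ cong (_÷₀ ℕ→ℚ (suc q)) (trans (sym (ℕ→ℚ-* 2 (suc q ℕ.* A)))
         (trans (cong ℕ→ℚ (solve 2 (λ s a → con 2 :* (s :* a) := s :* (con 2 :* a)) refl (suc q) A))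
                (ℕ→ℚ-* (suc q) (2 ℕ.* A)))) ⟩
  (ℕ→ℚ (suc q) ℚ.* ℕ→ℚ (2 ℕ.* A)) ÷₀ ℕ→ℚ (suc q)
    ≡⟨ *-÷₀-cancelˡ (ℕ→ℚ (2 ℕ.* A)) (ℕ→ℚ-suc≢0 q) ⟩
  ℕ→ℚ (2 ℕ.* A)
    ∎
  where open ≡-Reasoning

excess≤pairs : ∀ {λ′ Q} M → 0 ℕ.< M → λ′ ℕ.* λ′ ℕ.≤ M ℕ.* (λ′ ℕ.+ 2 ℕ.* Q) →
               (ℕ→ℚ (λ′ ℕ.* λ′) ÷₀ ℕ→ℚ (2 ℕ.* M)) ℚ.- (ℕ→ℚ λ′ ÷₀ ℕ→ℚ 2) ℚ.≤ ℕ→ℚ Q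
excess≤pairs {λ′} {Q} M@(suc M′) _ λ²≤ =
  ℚ.*-cancelʳ-≤-pos (ℕ→ℚ (2 ℕ.* M)) {{ℕ→ℚ-suc-positive (M′ ℕ.+ suc (M′ ℕ.+ 0))}} (begin
    ((λ² ÷₀ ℕ→ℚ (2 ℕ.* M)) ℚ.- (λq ÷₀ ℕ→ℚ 2)) ℚ.* ℕ→ℚ (2 ℕ.* M)
      ≡⟨ [x-y]*z≡x*z-y*z (λ² ÷₀ ℕ→ℚ (2 ℕ.* M)) (λq ÷₀ ℕ→ℚ 2) (ℕ→ℚ (2 ℕ.* M)) ⟩
    (λ² ÷₀ ℕ→ℚ (2 ℕ.* M)) ℚ.* ℕ→ℚ (2 ℕ.* M) ℚ.- (λq ÷₀ ℕ→ℚ 2) ℚ.* ℕ→ℚ (2 ℕ.* M)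
      ≡⟨ cong₂ ℚ._-_ (÷₀-*-cancel (ℕ→ℚ-suc≢0 (M′ ℕ.+ suc (M′ ℕ.+ 0))))
                     (trans (cong ((λq ÷₀ ℕ→ℚ 2) ℚ.*_) (ℕ→ℚ-* 2 M))
                     (trans (sym (ℚ.*-assoc (λq ÷₀ ℕ→ℚ 2) (ℕ→ℚ 2) (ℕ→ℚ M))) (cong (ℚ._* ℕ→ℚ M) (÷₀-*-cancel {p = λq} (ℕ→ℚ-suc≢0 1))))) ⟩
    λ² ℚ.- λq ℚ.* ℕ→ℚ M
      ≤⟨ ℚ.+-monoˡ-≤ (ℚ.- (λq ℚ.* ℕ→ℚ M)) (ℕ→ℚ-mono-≤ λ²≤′) ⟩
    ℕ→ℚ (Q ℕ.* (2 ℕ.* M) ℕ.+ λ′ ℕ.* M) ℚ.- λq ℚ.* ℕ→ℚ M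
      ≡⟨ cong (ℚ._- λq ℚ.* ℕ→ℚ M) (trans (ℕ→ℚ-+ (Q ℕ.* (2 ℕ.* M)) (λ′ ℕ.* M)) (cong (ℕ→ℚ (Q ℕ.* (2 ℕ.* M)) ℚ.+_) (ℕ→ℚ-* λ′ M))) ⟩
    ℕ→ℚ (Q ℕ.* (2 ℕ.* M)) ℚ.+ λq ℚ.* ℕ→ℚ M ℚ.- λq ℚ.* ℕ→ℚ M
      ≡⟨ x+y-y≡x (ℕ→ℚ (Q ℕ.* (2 ℕ.* M))) (λq ℚ.* ℕ→ℚ M) ⟩
    ℕ→ℚ (Q ℕ.* (2 ℕ.* M))
      ≡⟨ ℕ→ℚ-* Q (2 ℕ.* M) ⟩
    ℕ→ℚ Q ℚ.* ℕ→ℚ (2 ℕ.* M)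
      ∎)
  where
  open ℚ.≤-Reasoning
  λ² λq : ℚ
  λ² = ℕ→ℚ (λ′ ℕ.* λ′)
  λq = ℕ→ℚ λ′
  λ²≤′ : λ′ ℕ.* λ′ ℕ.≤ Q ℕ.* (2 ℕ.* M) ℕ.+ λ′ ℕ.* M
  λ²≤′ = ℕ.≤-trans λ²≤ (ℕ.≤-reflexive (solve 3 (λ M L Q → M :* (L :+ con 2 :* Q) := Q :* (con 2 :* M) :+ L :* M) refl M λ′ Q))

square÷₀≤ : ∀ {X D P} den → X ℕ.* X ℕ.≤ D ℕ.* P → X ℕ.≤ P → P ℕ.≤ den → ℕ→ℚ (X ℕ.* X) ÷₀ ℕ→ℚ den ℚ.≤ ℕ→ℚ D
square÷₀≤ {zero}  {D} den _ _ _ = subst (ℚ._≤ ℕ→ℚ D) (sym (0÷₀q≡0 (ℕ→ℚ den))) (ℕ→ℚ-mono-≤ {0} {D} z≤n)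
square÷₀≤ {suc X} zero _ X<P P≤0 with () ← ℕ.≤-trans X<P P≤0
square÷₀≤ {suc X} {D} (suc den′) X²≤DP _ P≤den =
  ÷₀-≤ den′ (subst (ℕ→ℚ (suc X ℕ.* suc X) ℚ.≤_) (ℕ→ℚ-* D (suc den′)) (ℕ→ℚ-mono-≤ (ℕ.≤-trans X²≤DP (ℕ.*-monoʳ-≤ D P≤den))))

ceiling-square÷₀≤ : ∀ {X D P num den} den′ → num ≡ + (X ℕ.* X) → den ≡ + den′ →
                    X ℕ.* X ℕ.≤ D ℕ.* P → X ℕ.≤ P → P ℕ.≤ den′ → ceiling (ℤ→ℚ num ÷₀ ℤ→ℚ den) ℤ.≤ + D
ceiling-square÷₀≤ {X} {D} {P} den′ refl refl X²≤DP X≤P P≤den =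
  ceiling-≤ (ℕ→ℚ (X ℕ.* X) ÷₀ ℕ→ℚ den′) (+ D) (square÷₀≤ {X} {D} {P} den′ X²≤DP X≤P P≤den)

private
  +m-+n≡+[m∸n] : ∀ m n → n ℕ.≤ m → + m ℤ.- + n ≡ + (m ∸ n)
  +m-+n≡+[m∸n] m n n≤m = trans (ℤ.m-n≡m⊖n m n) (ℤ.⊖-≥ n≤m)

  nonNegative : ∀ i → + 0 ℤ.≤ i → Σ ℕ λ m → i ≡ + m
  nonNegative (+ m) _ = m , refl

module _ (k3 h′ : ℕ) {λ′ n : ℕ} (counts : EdgeCounts (3 ℕ.+ k3) h′ λ′ n) where

  open EdgeCounts counts

  private
    K N M : ℕ
    K = suc (suc k3)
    N = K ℕ.^ suc h′
    M = K ℕ.^ h′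

    outSquares+2*inPairs≡ : outSquares ℕ.+ 2 ℕ.* inPairs ≡ k3 ℕ.* λ′ ℕ.+ N
    outSquares+2*inPairs≡ = ℕ.+-cancelˡ-≡ (λ′ ℕ.+ λ′) _ _ (begin
      λ′ ℕ.+ λ′ ℕ.+ (outSquares ℕ.+ 2 ℕ.* inPairs)   ≡⟨ solve 3 (λ L Q P → L :+ L :+ (P :+ con 2 :* Q) := (L :+ con 2 :* Q) :+ P :+ L) refl λ′ inPairs outSquares ⟩
      (λ′ ℕ.+ 2 ℕ.* inPairs) ℕ.+ outSquares ℕ.+ λ′  ≡⟨ cong (λ t → t ℕ.+ outSquares ℕ.+ λ′) inSquares≡ ⟨
      inSquares ℕ.+ outSquares ℕ.+ λ′               ≡⟨ squares+λ≡ ⟩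
      K ℕ.* (λ′ ℕ.+ M)                              ≡⟨ solve 3 (λ k L M → (con 2 :+ k) :* (L :+ M) := L :+ L :+ (k :* L :+ (con 2 :+ k) :* M)) refl k3 λ′ M ⟩
      λ′ ℕ.+ λ′ ℕ.+ (k3 ℕ.* λ′ ℕ.+ N)               ∎)
      where open ≡-Reasoning

    excess : ℚ
    excess = (ℕ→ℚ (λ′ ℕ.* λ′) ÷₀ ℕ→ℚ (2 ℕ.* M)) ℚ.- (ℕ→ℚ λ′ ÷₀ ℕ→ℚ 2)

    excess⁺ : ℤ
    excess⁺ = + 0 ℤ.⊔ ceiling excess

    excess⁺≤inPairs : excess⁺ ℤ.≤ + inPairs
    excess⁺≤inPairs = ℤ.⊔-lub (ℤ.+≤+ z≤n) (ceiling-≤ excess (+ inPairs)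
      (excess≤pairs {λ′} {inPairs} M (ℕ.m^n>0 K h′) (subst (λ t → λ′ ℕ.* λ′ ℕ.≤ M ℕ.* t) inSquares≡ λ²≤)))

    denominator : ℤ
    denominator = (+ (k3 ℕ.* λ′)) ℤ.+ (+ N) ℤ.- ((+ 2) ℤ.* excess⁺)

    denominator≥outSquares : Σ ℕ λ den → denominator ≡ + den × outSquares ℕ.≤ den
    denominator≥outSquares with m₀ , excess⁺≡ ← nonNegative excess⁺ (ℤ.i≤i⊔j (+ 0) (ceiling excess)) =
      c ∸ 2 ℕ.* m₀ , denominator≡ , outSquares≤
      where
      c : ℕ
      c = k3 ℕ.* λ′ ℕ.+ N
      2m₀≤2Q : 2 ℕ.* m₀ ℕ.≤ 2 ℕ.* inPairs
      2m₀≤2Q = ℕ.*-monoʳ-≤ 2 (ℤ.drop‿+≤+ (subst (ℤ._≤ + inPairs) excess⁺≡ excess⁺≤inPairs))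
      denominator≡ : denominator ≡ + (c ∸ 2 ℕ.* m₀)
      denominator≡ = trans (cong₂ ℤ._-_ (sym (ℤ.pos-+ (k3 ℕ.* λ′) N)) (trans (cong ((+ 2) ℤ.*_) excess⁺≡) (sym (ℤ.pos-* 2 m₀))))
                           (+m-+n≡+[m∸n] c (2 ℕ.* m₀) (ℕ.≤-trans 2m₀≤2Q (subst (2 ℕ.* inPairs ℕ.≤_) outSquares+2*inPairs≡ (ℕ.m≤n+m _ outSquares))))
      outSquares≤ : outSquares ℕ.≤ c ∸ 2 ℕ.* m₀
      outSquares≤ = ℕ.≤-trans (ℕ.≤-reflexive (trans (sym (ℕ.m+n∸n≡m outSquares (2 ℕ.* inPairs))) (cong (_∸ 2 ℕ.* inPairs) outSquares+2*inPairs≡)))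
                              (ℕ.∸-monoʳ-≤ c 2m₀≤2Q)

    numerator≡ : (+ N) ℤ.- (+ λ′) ≡ + outWalks
    numerator≡ = trans (+m-+n≡+[m∸n] N λ′ (subst (λ′ ℕ.≤_) outWalks+λ≡ (ℕ.m≤n+m λ′ outWalks)))
                       (cong +_ (trans (cong (_∸ λ′) (sym outWalks+λ≡)) (ℕ.m+n∸n≡m outWalks λ′)))

    numerator² : ℤ
    numerator² = ((+ N) ℤ.- (+ λ′)) ℤ.* ((+ N) ℤ.- (+ λ′))

    ceiling≤outEnds : ceiling (ℤ→ℚ numerator² ÷₀ ℤ→ℚ denominator) ℤ.≤ + outEnds
    ceiling≤outEnds = ceiling-square÷₀≤ (proj₁ denominator≥outSquares) numerator²≡ (proj₁ (proj₂ denominator≥outSquares))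
                        outWalks²≤ outWalks≤ (proj₂ (proj₂ denominator≥outSquares))
      where
      numerator²≡ : numerator² ≡ + (outWalks ℕ.* outWalks)
      numerator²≡ = trans (cong₂ ℤ._*_ numerator≡ numerator≡) (sym (ℤ.pos-* outWalks outWalks))

    treeSize : ℕ
    treeSize = ∑[ j < suc h′ ] (K ℕ.^ toℕ j)

    secondTerm : ℚ
    secondTerm = ℤ→ℚ (ceiling (ℤ→ℚ numerator² ÷₀ ℤ→ℚ denominator))

  egrBound≤ : egrBound (3 ℕ.+ k3) (suc h′) λ′ ℚ.≤ ℕ→ℚ n
  egrBound≤ = begin
    ((ℕ→ℚ 2 ℚ.* (ℕ→ℚ N ℚ.- ℕ→ℚ 1)) ÷₀ ℕ→ℚ (suc k3)) ℚ.+ secondTerm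
      ≡⟨ cong (ℚ._+ secondTerm) (2*[N-1]÷₀[1+q]≡2*A k3 {N} {treeSize} (geometric-sum (suc k3) (suc h′))) ⟩
    ℕ→ℚ (2 ℕ.* treeSize) ℚ.+ secondTerm
      ≤⟨ ℚ.+-monoʳ-≤ (ℕ→ℚ (2 ℕ.* treeSize)) (ℤ→ℚ-mono-≤ ceiling≤outEnds) ⟩
    ℕ→ℚ (2 ℕ.* treeSize) ℚ.+ ℕ→ℚ outEnds
      ≡⟨ ℕ→ℚ-+ (2 ℕ.* treeSize) outEnds ⟨
    ℕ→ℚ (2 ℕ.* treeSize ℕ.+ outEnds)
      ≤⟨ ℕ→ℚ-mono-≤ twoBalls+outEnds≤ ⟩
    ℕ→ℚ n
      ∎
    where open ℚ.≤-Reasoning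


edgeOfCycle : ∀ {n ℓ} (G : Graph n) → HasCycleOfLength G ℓ → ∃₂ λ u v → Graph.Adj G u v
edgeOfCycle G (_ , u ∷ v ∷ _ , _ , (_ , u~v ∷ _)) = u , v , u~v
edgeOfCycle G (s≤s (s≤s (s≤s _)) , _ ∷ [] , () , _)

mainTheorem16 : (n k g h λ' : ℕ) (G : Graph n) →
    3 ≤ k → EdgeGirthRegular G k g λ' → g ≡ 2 * h →
    egrBound k h λ' ≤ℚ ((+ n) / 1)
mainTheorem16 n _ _ (suc h′@(suc _)) λ' G (s≤s (s≤s (s≤s {n = k3} _))) (_ , regular , (cycle , noShortCycle) , edgeRegular) refl
  with u , v , u~v ← edgeOfCycle G cycle
  = egrBound≤ k3 h′ (Edge.edgeCounts u~v)
  where open EdgeCounting G regular h′ (s≤s z≤n) noShortCycle edgeRegular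
mainTheorem16 n _ _ zero       λ' G _ (_ , _ , ((() , _) , _) , _) refl
mainTheorem16 n _ _ (suc zero) λ' G _ (_ , _ , ((s≤s (s≤s ()) , _) , _) , _) refl
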